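{- Let $G$ be a graph with $n$ vertices and $\mathcal{P}=\{X_t\}_{1\leqslant t\leqslant p}$ a path decomposition of $G$ with $X_p=\emptyset$, with associated set of canonical paths $\Gamma_{\mathcal{P},G}$. Then for every $\lambda>0$, $$\rho(\Gamma_{\mathcal{P},G})\leqslant 4n^2\tilde\lambda^{2\alpha+1}\max_{1\leqslant t\leqslant p}|\mathcal{I}(G[X_t])|^2,$$ where $\tilde\lambda=e^{|\ln\lambda|}$ and $\alpha=\max_{1\leqslant t\leqslant p}\alpha(G[X_t])$.
   Context: A path decomposition is a sequence of bags $X_1,\dots,X_p\subseteq V(G)$ covering all vertices and edges, such that the bags containing any vertex form an interval. $\mathcal{I}(H)$: independent sets of $H$; $\pi(I)=\lambda^{|I|}/Z_G(\lambda)$ with $Z_G(\lambda)=\sum_{J\in\mathcal{I}(G)}\lambda^{|J|}$. Glauber transitions: $P(I,I\cup\{v\})=\frac1n\frac{\lambda}{\lambda+1}$ if $v\notin I$ and $I\cup\{v\}$ independent; $P(I,I\setminus\{v\})=\frac1n\frac{1}{\lambda+1}$ if $v\in I$; $P(I,I)$ is the remaining probability. Canonical path $\gamma_{I,J}$ from $I$ to $J$ (each step adds or removes one vertex): step 1 removes the vertices of $I\cap X_1$ (arbitrary order); then for $i=2,\dots,p$ successively, step $i$ removes the (remaining) vertices of $I\cap X_i$ in arbitrary order, then adds the vertices of $J\cap(X_{i-1}\setminus X_i)$ in arbitrary order. $\Gamma_{\mathcal{P},G}=\{\gamma_{I,J}:I,J\in\mathcal{I}(G)\}$. Congestion of a transition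 $e=(W,W')$ with $P(W,W')>0$: $\rho(\Gamma,e)=\frac{1}{\pi(W)P(W,W')}\sum_{K,L:\ \gamma_{K,L}\text{ uses }e}\pi(K)\pi(L)|\gamma_{K,L}|$; $\rho(\Gamma)=\max_{e:P(e)>0}\rho(\Gamma,e)$.
   Formalization: The parameter λ ranges over the positive rationals. -}

module Defs where

open import Data.Bool using (Bool; true; false; _∧_; _∨_; not; if_then_else_)
open import Data.Nat as ℕ using (ℕ; zero; suc; _<ᵇ_)
open import Data.Nat using () renaming (_⊔_ to _⊔ℕ_)
open import Data.Fin using (Fin; zero; suc; toℕ; inject₁)
open import Data.Vec using (Vec; []; _∷_; lookup; replicate; _[_]≔_)
open import Data.List as List using (List; []; _∷_; map; filterᵇ; foldr; length; allFin; concat; _++_)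
open import Data.Bool.ListAction using (any; all)
open import Data.List.Relation.Binary.Permutation.Propositional using (_↭_)
open import Data.Product using (Σ; _×_; _,_; ∃)
open import Data.Integer using (+_)
open import Data.Rational as ℚ using (ℚ; 0ℚ; 1ℚ; _+_; _*_; _-_; _⊔_; _≟_; 1/_; ≢-nonZero)
open import Relation.Binary.PropositionalEquality using (_≡_)
open import Relation.Nullary using (yes; no)

Subset : ℕ → Set
Subset n = Vec Bool n

∅ : ∀ {n} → Subset n
∅ = replicate _ false

allSubsets : (n : ℕ) → List (Subset n)
allSubsets zero = [] ∷ []
allSubsets (suc n) = map (false ∷_) (allSubsets n) List.++ map (true ∷_) (allSubsets n)

_==ˢ_ : ∀ {n} → Subset n → Subset n → Bool
[] ==ˢ [] = true
(x ∷ xs) ==ˢ (y ∷ ys) = (if x then y else not y) ∧ (xs ==ˢ ys)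

_⊆ᵇ_ : ∀ {n} → Subset n → Subset n → Bool
[] ⊆ᵇ [] = true
(x ∷ xs) ⊆ᵇ (y ∷ ys) = (not x ∨ y) ∧ (xs ⊆ᵇ ys)

∣_∣ˢ : ∀ {n} → Subset n → ℕ
∣ [] ∣ˢ = 0
∣ true ∷ xs ∣ˢ = suc ∣ xs ∣ˢ
∣ false ∷ xs ∣ˢ = ∣ xs ∣ˢ

record Graph (n : ℕ) : Set where
  field
    adj    : Fin n → Fin n → Bool
    sym    : ∀ u v → adj u v ≡ adj v u
    irrefl : ∀ v → adj v v ≡ false
open Graph public

isIndep : ∀ {n} → Graph n → Subset n → Bool
isIndep {n} G I =
  all (λ u → all (λ v → not (lookup I u ∧ lookup I v ∧ adj G u v)) (allFin n)) (allFin n)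

Indep : ∀ {n} → Graph n → Subset n → Set
Indep G I = isIndep G I ≡ true

indeps : ∀ {n} → Graph n → List (Subset n)
indeps {n} G = filterᵇ (isIndep G) (allSubsets n)

indepsIn : ∀ {n} → Graph n → Subset n → List (Subset n)
indepsIn G X = filterᵇ (λ S → S ⊆ᵇ X) (indeps G)

alphaIn : ∀ {n} → Graph n → Subset n → ℕ
alphaIn G X = foldr (λ S m → ∣ S ∣ˢ ⊔ℕ m) 0 (indepsIn G X)

-- Path decomposition with p = suc q bags X 0, …, X q (0-indexed; X t is the paper's X_{t+1}).
record IsPathDecomp {n q : ℕ} (G : Graph n) (X : Fin (suc q) → Subset n) : Set where
  field
    coverV   : ∀ v → ∃ λ t → lookup (X t) v ≡ true
    coverE   : ∀ u v → adj G u v ≡ true →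
               ∃ λ t → (lookup (X t) u ≡ true) × (lookup (X t) v ≡ true)
    interval : ∀ v (i j k : Fin (suc q)) → toℕ i ℕ.≤ toℕ j → toℕ j ℕ.≤ toℕ k →
               lookup (X i) v ≡ true → lookup (X k) v ≡ true → lookup (X j) v ≡ true

data Move (n : ℕ) : Set where
  add : Fin n → Move n
  rem : Fin n → Move n

applyMove : ∀ {n} → Move n → Subset n → Subset n
applyMove (add v) W = W [ v ]≔ true
applyMove (rem v) W = W [ v ]≔ false

transitions : ∀ {n} → Subset n → List (Move n) → List (Subset n × Subset n)
transitions W [] = []
transitions W (m ∷ ms) = (W , applyMove m W) ∷ transitions (applyMove m W) ms

module _ {n q : ℕ} (X : Fin (suc q) → Subset n) where

  removeList : Subset n → Fin (suc q) → List (Fin n)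
  removeList I t = filterᵇ
    (λ v → lookup I v ∧ lookup (X t) v ∧
           not (any (λ j → (toℕ j <ᵇ toℕ t) ∧ lookup (X j) v) (allFin (suc q))))
    (allFin n)

  addList : Subset n → Fin (suc q) → List (Fin n)
  addList J zero = []
  addList J (suc s) = filterᵇ
    (λ v → lookup J v ∧ lookup (X (inject₁ s)) v ∧ not (lookup (X (suc s)) v))
    (allFin n)

  -- ms is a canonical path from I to J (for some choice of the arbitrary orders)
  IsCanonical : Subset n → Subset n → List (Move n) → Set
  IsCanonical I J ms =
    Σ (Fin (suc q) → List (Fin n)) λ R →
    Σ (Fin (suc q) → List (Fin n)) λ A →
      (∀ t → R t ↭ removeList I t) ×
      (∀ t → A t ↭ addList J t) ×
      (ms ≡ concat (map (λ t → map rem (R t) ++ map add (A t)) (allFin (suc q))))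

-- total inverse (inv 0 = 0); only ever applied to nonzero values below
inv : ℚ → ℚ
inv p with p ≟ 0ℚ
... | yes _ = 0ℚ
... | no p≢0 = 1/_ p {{≢-nonZero p≢0}}

ℕtoℚ : ℕ → ℚ
ℕtoℚ k = + k ℚ./ 1

_^ℚ_ : ℚ → ℕ → ℚ
x ^ℚ zero = 1ℚ
x ^ℚ suc k = x * (x ^ℚ k)

sumℚ : List ℚ → ℚ
sumℚ = foldr _+_ 0ℚ

module _ {n : ℕ} (G : Graph n) (lam : ℚ) where

  Z : ℚ
  Z = sumℚ (map (λ J → lam ^ℚ ∣ J ∣ˢ) (indeps G))

  π : Subset n → ℚ
  π I = (lam ^ℚ ∣ I ∣ˢ) * inv Z

  moveProb : Subset n → Fin n → ℚ
  moveProb W v =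
    if lookup W v
    then inv (ℕtoℚ n) * inv (lam + 1ℚ)
    else (if isIndep G (W [ v ]≔ true)
          then inv (ℕtoℚ n) * (lam * inv (lam + 1ℚ))
          else 0ℚ)

  flip : Subset n → Fin n → Subset n
  flip W v = W [ v ]≔ not (lookup W v)

  P : Subset n → Subset n → ℚ
  P W W' =
    if W ==ˢ W'
    then 1ℚ - sumℚ (map (moveProb W) (allFin n))
    else sumℚ (map (λ v → if flip W v ==ˢ W' then moveProb W v else 0ℚ) (allFin n))

  congestion : (Subset n → Subset n → List (Move n)) → Subset n → Subset n → ℚ
  congestion γ W W' =
    inv (π W * P W W') *
    sumℚ (map (λ K → sumℚ (map (λ L →
       if any (λ e → (Data.Product.proj₁ e ==ˢ W) ∧ (Data.Product.proj₂ e ==ˢ W'))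
              (transitions K (γ K L))
       then π K * π L * ℕtoℚ (length (γ K L))
       else 0ℚ) (indeps G))) (indeps G))

-- right-hand side 4 n² λ̃^(2α+1) max_t |𝓘(G[X_t])|²,  λ̃ = max(λ, 1/λ) = e^{|ln λ|}
bound : ∀ {n q} → Graph n → (Fin (suc q) → Subset n) → ℚ → ℚ
bound {n} {q} G X lam =
  ℕtoℚ 4 * ℕtoℚ (n ℕ.* n) * ((lam ⊔ inv lam) ^ℚ (2 ℕ.* α ℕ.+ 1)) * ℕtoℚ (M ℕ.* M)
  where
    α = foldr (λ t m → alphaIn G (X t) ⊔ℕ m) 0 (allFin (suc q))
    M = foldr (λ t m → length (indepsIn G (X t)) ⊔ℕ m) 0 (allFin (suc q))

-- Let the transition W → W′ flip the vertex v. Every canonical path K → L using it makes this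
-- move in one and the same bag X t (the first bag of v if v ∈ W, the bag after its last one
-- otherwise), and at that moment W agrees with K on the vertices first met after X t and with L
-- on those last met before X t⁻, the bag preceding X t. Hence (K, L) is determined by
-- η = (K on the vertices last met before X t) ∪ (L on those first met in or after X t),
-- K ∩ X t and L ∩ X t⁻. No edge crosses bag t, so η is independent, and counting each vertex
-- gives |K| + |L| + |W ∩ (X t ∪ X t⁻)| = |η| + |W| + |K ∩ X t| + |L ∩ X t⁻|, whence
-- π(K) π(L) ≤ λ̃^{2α} π(η) π(W). Summing over this injective image, with |γ K L| ≤ 2n,
-- Σ π(η) = 1 and P(W, W′) ≥ 1/(2nλ̃), gives the bound.

module Submission where

open import Defs hiding (sym)
open import Data.Bool using (Bool; true; false; _∧_; _∨_; not; if_then_else_; T?)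
open import Data.Bool.ListAction using (any; all)
open import Data.Bool.Properties using (T-≡; not-involutive; not-¬)
open import Data.Empty using (⊥-elim)
open import Data.Fin as Fin using (Fin; zero; suc; toℕ; fromℕ; fromℕ<; inject₁)
import Data.Fin.Properties as Fin
open import Data.Fin.Subset using (_∩_; _∪_)
import Data.Fin.Subset.Properties as Subset
open import Data.List using (List; []; _∷_; map; filterᵇ; allFin; _++_; concat; length; foldr; cartesianProduct)
import Data.List.Properties as List
open import Data.List.Membership.Propositional using (_∈_; _∉_; find; lose)
open import Data.List.Membership.Propositional.Properties
import Data.List.Relation.Binary.Permutation.Propositional as ↭
open ↭ using (_↭_; ↭-sym; ↭⇒↭ₛ)
open import Data.List.Relation.Binary.Permutation.Propositional.Properties using (shift; ∈-resp-↭)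
open import Data.List.Relation.Unary.All as All using (All; []; _∷_)
import Data.List.Relation.Unary.All.Properties as AllP
open import Data.List.Relation.Unary.AllPairs using (AllPairs; []; _∷_)
import Data.List.Relation.Unary.AllPairs.Properties as AllPairs
open import Data.List.Relation.Unary.Any using (here; there)
open import Data.List.Relation.Unary.Any.Properties using (any⁺; any⁻)
open import Data.List.Relation.Unary.Unique.Propositional using (Unique)
import Data.List.Relation.Unary.Unique.Propositional.Properties as Unique
open import Data.Nat as ℕ using (ℕ; zero; suc; z≤n; s≤s)
import Data.Nat.Properties as ℕ
open import Data.Nat.ListAction using (sum)
open import Data.Nat.Tactic.RingSolver using (solve-∀)
open import Algebra.Properties.CommutativeMonoid.Sum ℕ.+-0-commutativeMonoid
  using (sum-syntax; ∑-distrib-+; sum-cong-≗; sum-replicate-zero)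
import Data.Nat.Coprimality as Coprime
import Data.Integer as ℤ
import Data.Integer.Properties as ℤ
open import Data.Product using (∃; _×_; _,_; proj₁; proj₂; uncurry)
open import Data.Sum using (_⊎_; inj₁; inj₂)
open import Data.Vec using ([]; _∷_; lookup; tabulate; _[_]≔_)
import Data.Vec.Properties as Vec
open import Function using (_∘_; Equivalence)
open import Relation.Binary.Definitions using (tri<; tri≈; tri>)
open import Relation.Binary.PropositionalEquality
open import Relation.Nullary using (¬_; yes; no)

open Equivalence using (to; from)

module _ {A : Set} (p : A → Bool) where

  ∈-filterᵇ⁺ : ∀ {x xs} → x ∈ xs → p x ≡ true → x ∈ filterᵇ p xs
  ∈-filterᵇ⁺ x∈ px = ∈-filter⁺ (T? ∘ p) x∈ (T-≡ .from px)

  ∈-filterᵇ⁻ : ∀ {x} xs → x ∈ filterᵇ p xs → x ∈ xs × p x ≡ true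
  ∈-filterᵇ⁻ xs x∈ = let x∈xs , px = ∈-filter⁻ (T? ∘ p) {xs = xs} x∈ in x∈xs , T-≡ .to px

  all≡true⁻ : ∀ {xs x} → all p xs ≡ true → x ∈ xs → p x ≡ true
  all≡true⁻ {xs} h x∈ = T-≡ .to (All.lookup (AllP.all⁺ p xs (T-≡ .from h)) x∈)

  all≡true⁺ : ∀ xs → (∀ {x} → x ∈ xs → p x ≡ true) → all p xs ≡ true
  all≡true⁺ xs h = T-≡ .to (AllP.all⁻ p (All.tabulate (T-≡ .from ∘ h)))

  any≡true⁻ : ∀ xs → any p xs ≡ true → ∃ λ x → x ∈ xs × p x ≡ true
  any≡true⁻ xs h = let x , x∈ , px = find (any⁻ p xs (T-≡ .from h)) in x , x∈ , T-≡ .to px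

  any≡true⁺ : ∀ {xs x} → x ∈ xs → p x ≡ true → any p xs ≡ true
  any≡true⁺ x∈ px = T-≡ .to (any⁺ p (lose x∈ (T-≡ .from px)))

∧≡true⁻ : ∀ {a b} → a ∧ b ≡ true → a ≡ true × b ≡ true
∧≡true⁻ {true} {true} _ = refl , refl

not≡true⁻ : ∀ {b} → not b ≡ true → b ≡ false
not≡true⁻ {false} _ = refl

true≢false : true ≢ false
true≢false ()

==ˢ⇒≡ : ∀ {n} (S S′ : Subset n) → (S ==ˢ S′) ≡ true → S ≡ S′
==ˢ⇒≡ []          []           _ = refl
==ˢ⇒≡ (true ∷ S)  (true ∷ S′)  h = cong (true ∷_) (==ˢ⇒≡ S S′ h)
==ˢ⇒≡ (false ∷ S) (false ∷ S′) h = cong (false ∷_) (==ˢ⇒≡ S S′ h)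

infix 4 _⊆_
_⊆_ : ∀ {n} → Subset n → Subset n → Set
S ⊆ S′ = ∀ u → lookup S u ≡ true → lookup S′ u ≡ true

⊆⇒⊆ᵇ : ∀ {n} (S S′ : Subset n) → S ⊆ S′ → (S ⊆ᵇ S′) ≡ true
⊆⇒⊆ᵇ []          []       _ = refl
⊆⇒⊆ᵇ (true ∷ S)  (x ∷ S′) h rewrite h zero refl = ⊆⇒⊆ᵇ S S′ (h ∘ suc)
⊆⇒⊆ᵇ (false ∷ S) (x ∷ S′) h = ⊆⇒⊆ᵇ S S′ (h ∘ suc)

lookup-∩ : ∀ {n} (S S′ : Subset n) u → lookup (S ∩ S′) u ≡ lookup S u ∧ lookup S′ u
lookup-∩ S S′ u = Vec.lookup-zipWith _∧_ u S S′

∩-⊆ʳ : ∀ {n} (S S′ : Subset n) → S ∩ S′ ⊆ S′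
∩-⊆ʳ S S′ u h = proj₂ (∧≡true⁻ (trans (sym (lookup-∩ S S′ u)) h))

∩-⊆ˡ : ∀ {n} (S S′ : Subset n) → S ∩ S′ ⊆ S
∩-⊆ˡ S S′ u h = proj₁ (∧≡true⁻ (trans (sym (lookup-∩ S S′ u)) h))

Subset-ext : ∀ {n} {S S′ : Subset n} → (∀ u → lookup S u ≡ lookup S′ u) → S ≡ S′
Subset-ext {S = S} {S′} S≗S′ = trans (sym (Vec.tabulate∘lookup S)) (trans (Vec.tabulate-cong S≗S′) (Vec.tabulate∘lookup S′))

∈-allSubsets : ∀ {n} (S : Subset n) → S ∈ allSubsets n
∈-allSubsets []                = here refl
∈-allSubsets {suc n} (false ∷ S) = ∈-++⁺ˡ (∈-map⁺ (false ∷_) (∈-allSubsets S))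
∈-allSubsets {suc n} (true ∷ S)  = ∈-++⁺ʳ (map (false ∷_) (allSubsets n)) (∈-map⁺ (true ∷_) (∈-allSubsets S))

allSubsets-unique : ∀ n → Unique (allSubsets n)
allSubsets-unique zero    = [] ∷ []
allSubsets-unique (suc n) =
  Unique.++⁺ (Unique.map⁺ ∷-injectiveʳ (allSubsets-unique n)) (Unique.map⁺ ∷-injectiveʳ (allSubsets-unique n)) disjoint
  where
    ∷-injectiveʳ : ∀ {b} {S S′ : Subset n} → b ∷ S ≡ b ∷ S′ → S ≡ S′
    ∷-injectiveʳ refl = refl
    disjoint : ∀ {S} → ¬ (S ∈ map (false ∷_) (allSubsets n) × S ∈ map (true ∷_) (allSubsets n))
    disjoint (S∈ , S∈′) with ∈-map⁻ (false ∷_) S∈ | ∈-map⁻ (true ∷_) S∈′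
    ... | _ , _ , refl | _ , _ , ()

module _ {n : ℕ} (G : Graph n) where

  Indep⇒nonadjacent : ∀ I → Indep G I → ∀ u v → lookup I u ≡ true → lookup I v ≡ true → adj G u v ≡ false
  Indep⇒nonadjacent I h u v Iu Iv = nonadjacent (not≡true⁻ (all≡true⁻ _ (all≡true⁻ _ h (∈-allFin u)) (∈-allFin v)))
    where
      nonadjacent : (lookup I u ∧ lookup I v ∧ adj G u v) ≡ false → adj G u v ≡ false
      nonadjacent e rewrite Iu | Iv = e

  nonadjacent⇒Indep : ∀ I → (∀ u v → lookup I u ≡ true → lookup I v ≡ true → adj G u v ≡ false) → Indep G I
  nonadjacent⇒Indep I h = all≡true⁺ _ (allFin n) λ {u} _ → all≡true⁺ _ (allFin n) λ {v} _ → pair u v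
    where
      pair : ∀ u v → not (lookup I u ∧ lookup I v ∧ adj G u v) ≡ true
      pair u v with lookup I u in Iu | lookup I v in Iv
      ... | false | _     = refl
      ... | true  | false = refl
      ... | true  | true  rewrite h u v Iu Iv = refl

  Indep-⊆ : ∀ {I J} → Indep G I → J ⊆ I → Indep G J
  Indep-⊆ {I} {J} h J⊆I = nonadjacent⇒Indep J λ u v Ju Jv → Indep⇒nonadjacent I h u v (J⊆I u Ju) (J⊆I v Jv)

  ∈-indeps⁺ : ∀ {I} → Indep G I → I ∈ indeps G
  ∈-indeps⁺ {I} h = ∈-filterᵇ⁺ (isIndep G) (∈-allSubsets I) h

  ∈-indeps⁻ : ∀ {I} → I ∈ indeps G → Indep G I
  ∈-indeps⁻ I∈ = proj₂ (∈-filterᵇ⁻ (isIndep G) (allSubsets n) I∈)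

  indeps-unique : Unique (indeps G)
  indeps-unique = Unique.filter⁺ (T? ∘ isIndep G) (allSubsets-unique n)

  ∈-indepsIn⁺ : ∀ {X I} → Indep G I → I ⊆ X → I ∈ indepsIn G X
  ∈-indepsIn⁺ {X} {I} h I⊆X = ∈-filterᵇ⁺ (_⊆ᵇ X) (∈-indeps⁺ h) (⊆⇒⊆ᵇ I X I⊆X)

bit : Bool → ℕ
bit true  = 1
bit false = 0

∣∣≡∑ : ∀ {n} (S : Subset n) → ∣ S ∣ˢ ≡ ∑[ u < n ] bit (lookup S u)
∣∣≡∑ []          = refl
∣∣≡∑ (true ∷ S)  = cong suc (∣∣≡∑ S)
∣∣≡∑ (false ∷ S) = ∣∣≡∑ S

multiplicity : ∀ {n} → Fin n → List (Subset n) → ℕ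
multiplicity u Ss = sum (map (λ S → bit (lookup S u)) Ss)

∑∣∣≡∑multiplicity : ∀ {n} (Ss : List (Subset n)) → sum (map ∣_∣ˢ Ss) ≡ ∑[ u < n ] multiplicity u Ss
∑∣∣≡∑multiplicity {n} []       = sym (sum-replicate-zero n)
∑∣∣≡∑multiplicity {n} (S ∷ Ss) = begin
  ∣ S ∣ˢ ℕ.+ sum (map ∣_∣ˢ Ss)                                ≡⟨ cong₂ ℕ._+_ (∣∣≡∑ S) (∑∣∣≡∑multiplicity Ss) ⟩
  ∑[ u < n ] bit (lookup S u) ℕ.+ ∑[ u < n ] multiplicity u Ss ≡⟨ ∑-distrib-+ (λ u → bit (lookup S u)) (λ u → multiplicity u Ss) ⟨
  ∑[ u < n ] multiplicity u (S ∷ Ss)                          ∎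
  where open ≡-Reasoning

double-counting : ∀ {n} (Ss Ss′ : List (Subset n)) → (∀ u → multiplicity u Ss ≡ multiplicity u Ss′) →
                  sum (map ∣_∣ˢ Ss) ≡ sum (map ∣_∣ˢ Ss′)
double-counting Ss Ss′ h = trans (∑∣∣≡∑multiplicity Ss) (trans (sum-cong-≗ h) (sym (∑∣∣≡∑multiplicity Ss′)))

∣∪∣≤∣∣+∣∣ : ∀ {n} (S S′ : Subset n) → ∣ S ∪ S′ ∣ˢ ℕ.≤ ∣ S ∣ˢ ℕ.+ ∣ S′ ∣ˢ
∣∪∣≤∣∣+∣∣ []          []           = z≤n
∣∪∣≤∣∣+∣∣ (false ∷ S) (false ∷ S′) = ∣∪∣≤∣∣+∣∣ S S′
∣∪∣≤∣∣+∣∣ (false ∷ S) (true ∷ S′)  = subst (suc ∣ S ∪ S′ ∣ˢ ℕ.≤_) (sym (ℕ.+-suc _ _)) (s≤s (∣∪∣≤∣∣+∣∣ S S′))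
∣∪∣≤∣∣+∣∣ (true ∷ S)  (b ∷ S′)     = s≤s (ℕ.≤-trans (∣∪∣≤∣∣+∣∣ S S′) (ℕ.+-monoʳ-≤ _ (∣S∣≤∣b∷S∣ b S′)))
  where
    ∣S∣≤∣b∷S∣ : ∀ {k} b (S : Subset k) → ∣ S ∣ˢ ℕ.≤ ∣ b ∷ S ∣ˢ
    ∣S∣≤∣b∷S∣ true  S = ℕ.n≤1+n _
    ∣S∣≤∣b∷S∣ false S = ℕ.≤-refl

module _ {A : Set} where

  AllPairs-split : ∀ {R : A → A → Set} pre x suf → AllPairs R (pre ++ x ∷ suf) →
                   AllPairs R pre × All (λ y → R y x) pre × All (R x) suf
  AllPairs-split []        x suf (x<suf ∷ _) = [] , [] , x<suf
  AllPairs-split (y ∷ pre) x suf (y<rest ∷ rest) =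
    let pre-ok , pre<x , x<suf = AllPairs-split pre x suf rest
        y<pre , y<x∷suf = AllP.++⁻ pre y<rest
    in  (y<pre ∷ pre-ok) , (All.head y<x∷suf ∷ pre<x) , x<suf

  unique-∉-suffix : ∀ (pre : List A) {x} suf → Unique (pre ++ x ∷ suf) → x ∉ suf
  unique-∉-suffix []        suf (x∉suf ∷ _) x∈suf = All.lookup x∉suf x∈suf refl
  unique-∉-suffix (_ ∷ pre) suf (_ ∷ uniq)  = unique-∉-suffix pre suf uniq

module _ {n : ℕ} where

  vertex : Move n → Fin n
  vertex (add v) = v
  vertex (rem v) = v

  value : Move n → Bool
  value (add _) = true
  value (rem _) = false

  lookup∘applyMove : ∀ m W → lookup (applyMove m W) (vertex m) ≡ value m
  lookup∘applyMove (add v) W = Vec.lookup∘update v W true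
  lookup∘applyMove (rem v) W = Vec.lookup∘update v W false

  lookup∘applyMove′ : ∀ m W {u} → vertex m ≢ u → lookup (applyMove m W) u ≡ lookup W u
  lookup∘applyMove′ (add v) W v≢u = Vec.lookup∘update′ (v≢u ∘ sym) W true
  lookup∘applyMove′ (rem v) W v≢u = Vec.lookup∘update′ (v≢u ∘ sym) W false

  run : List (Move n) → Subset n → Subset n
  run []       W = W
  run (m ∷ ms) W = run ms (applyMove m W)

  run-++ : ∀ ms ms′ W → run (ms ++ ms′) W ≡ run ms′ (run ms W)
  run-++ []       ms′ W = refl
  run-++ (m ∷ ms) ms′ W = run-++ ms ms′ (applyMove m W)

  ∈-transitions⁻ : ∀ W ms {W₀ W₁} → (W₀ , W₁) ∈ transitions W ms →
    ∃ λ pre → ∃ λ m → ∃ λ suf → ms ≡ pre ++ m ∷ suf × W₀ ≡ run pre W × W₁ ≡ applyMove m W₀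
  ∈-transitions⁻ W (m ∷ ms) (here refl) = [] , m , ms , refl , refl , refl
  ∈-transitions⁻ W (m ∷ ms) (there e∈) =
    let pre , m′ , suf , ms≡ , W₀≡ , W₁≡ = ∈-transitions⁻ (applyMove m W) ms e∈
    in  m ∷ pre , m′ , suf , cong (m ∷_) ms≡ , W₀≡ , W₁≡

  lookup-run-untouched : ∀ ms W u → rem u ∉ ms → add u ∉ ms → lookup (run ms W) u ≡ lookup W u
  lookup-run-untouched []       W u _   _   = refl
  lookup-run-untouched (m ∷ ms) W u r∉ a∉ =
    trans (lookup-run-untouched ms (applyMove m W) u (r∉ ∘ there) (a∉ ∘ there)) (lookup∘applyMove′ m W (elsewhere m r∉ a∉))
    where
      elsewhere : ∀ m → rem u ∉ m ∷ ms → add u ∉ m ∷ ms → vertex m ≢ u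
      elsewhere (add v) _ a∉′ refl = a∉′ (here refl)
      elsewhere (rem v) r∉′ _ refl = r∉′ (here refl)

  lookup-run-last : ∀ pre m suf W → rem (vertex m) ∉ suf → add (vertex m) ∉ suf →
                    lookup (run (pre ++ m ∷ suf) W) (vertex m) ≡ value m
  lookup-run-last pre m suf W r∉ a∉ = begin
    lookup (run (pre ++ m ∷ suf) W) (vertex m)            ≡⟨ cong (λ W′ → lookup W′ (vertex m)) (run-++ pre (m ∷ suf) W) ⟩
    lookup (run suf (applyMove m (run pre W))) (vertex m) ≡⟨ lookup-run-untouched suf _ (vertex m) r∉ a∉ ⟩
    lookup (applyMove m (run pre W)) (vertex m)           ≡⟨ lookup∘applyMove m (run pre W) ⟩
    value m                                               ∎
    where open ≡-Reasoning

  lookup-run-removed : ∀ ms W {u} → Unique ms → rem u ∈ ms → add u ∉ ms → lookup (run ms W) u ≡ false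
  lookup-run-removed ms W {u} uniq r∈ a∉ with ∈-∃++ r∈
  ... | xs , ys , refl = lookup-run-last xs (rem u) ys W (unique-∉-suffix xs ys uniq) (a∉ ∘ ∈-++⁺ʳ xs ∘ there)

  flipMove : Subset n → Fin n → Move n
  flipMove W v = if lookup W v then rem v else add v

  flipMove-flips : ∀ W v → lookup W (vertex (flipMove W v)) ≡ not (value (flipMove W v))
  flipMove-flips W v with lookup W v in Wv
  ... | true  = Wv
  ... | false = Wv

  flip≡applyMove : ∀ G lam W v → flip {n} G lam W v ≡ applyMove (flipMove W v) W
  flip≡applyMove G lam W v with lookup W v
  ... | true  = refl
  ... | false = refl

  flipping-move-unique : ∀ {m m′ : Move n} {W} → applyMove m W ≡ applyMove m′ W →
                         lookup W (vertex m) ≡ not (value m) → lookup W (vertex m′) ≡ not (value m′) → m ≡ m′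
  flipping-move-unique {m} {m′} {W} same flips flips′ with vertex m Fin.≟ vertex m′
  ... | no m≢m′ = ⊥-elim (not-¬ refl (begin
    value m                             ≡⟨ lookup∘applyMove m W ⟨
    lookup (applyMove m W) (vertex m)   ≡⟨ cong (λ W′ → lookup W′ (vertex m)) same ⟩
    lookup (applyMove m′ W) (vertex m)  ≡⟨ lookup∘applyMove′ m′ W (m≢m′ ∘ sym) ⟩
    lookup W (vertex m)                 ≡⟨ flips ⟩
    not (value m)                       ∎))
    where open ≡-Reasoning
  ... | yes m≡m′ = same-move m m′ m≡m′ (trans (written flips) (trans (cong (not ∘ lookup W) m≡m′) (sym (written flips′))))
    where
      written : ∀ {m} → lookup W (vertex m) ≡ not (value m) → value m ≡ not (lookup W (vertex m))
      written {m} flips″ = trans (sym (not-involutive (value m))) (cong not (sym flips″))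
      same-move : ∀ m m′ → vertex m ≡ vertex m′ → value m ≡ value m′ → m ≡ m′
      same-move (add v) (add .v) refl _ = refl
      same-move (rem v) (rem .v) refl _ = refl

module Schedule {n : ℕ} (τ : Move n → ℕ) (τ-rem<add : ∀ u → τ (rem u) ℕ.< τ (add u)) where
  open import Data.Nat using (_≤_; _<_)

  record IsSchedule (K L : Subset n) (ms : List (Move n)) : Set where
    field
      sorted : AllPairs (λ m m′ → τ m ≤ τ m′) ms
      unique : Unique ms
      rem∈⇒K : ∀ {u} → rem u ∈ ms → lookup K u ≡ true
      K⇒rem∈ : ∀ {u} → lookup K u ≡ true → rem u ∈ ms
      add∈⇒L : ∀ {u} → add u ∈ ms → lookup L u ≡ true
      L⇒add∈ : ∀ {u} → lookup L u ≡ true → add u ∈ ms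

  record Step (K L W W′ : Subset n) : Set where
    field
      move    : Move n
      W′≡     : W′ ≡ applyMove move W
      flips   : lookup W (vertex move) ≡ not (value move)
      agreesK : ∀ u → τ move < τ (rem u) → lookup W u ≡ lookup K u
      agreesL : ∀ u → τ (add u) < τ move → lookup W u ≡ lookup L u

  lookup-run-added : ∀ ms W {u} → Unique ms → AllPairs (λ m m′ → τ m ≤ τ m′) ms → add u ∈ ms → lookup (run ms W) u ≡ true
  lookup-run-added ms W {u} uniq sorted a∈ with ∈-∃++ a∈
  ... | xs , ys , refl = lookup-run-last xs (add u) ys W r∉ys (unique-∉-suffix xs ys uniq)
    where
      r∉ys : rem u ∉ ys
      r∉ys r∈ = ℕ.<⇒≱ (τ-rem<add u) (All.lookup (proj₂ (proj₂ (AllPairs-split xs (add u) ys sorted))) r∈)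

  step : ∀ {K L ms W W′} → IsSchedule K L ms → (W , W′) ∈ transitions K ms → Step K L W W′
  step {K} {L} {ms} sch e∈ with ∈-transitions⁻ K ms e∈
  ... | pre , m , suf , refl , refl , refl = record
    { move = m ; W′≡ = refl ; flips = flips m refl ; agreesK = agreesK ; agreesL = agreesL }
    where
      open IsSchedule sch
      split-sorted = AllPairs-split pre m suf sorted
      sorted-pre = proj₁ split-sorted

      pre-≤ : ∀ {x} → x ∈ pre → τ x ≤ τ m
      pre-≤ = All.lookup (proj₁ (proj₂ split-sorted))

      ≤-suf : ∀ {x} → x ∈ suf → τ m ≤ τ x
      ≤-suf = All.lookup (proj₂ (proj₂ split-sorted))

      split-unique = AllPairs-split pre m suf unique

      unique-pre : Unique pre
      unique-pre = proj₁ split-unique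

      m∉pre : m ∉ pre
      m∉pre m∈ = All.lookup (proj₁ (proj₂ split-unique)) m∈ refl

      m∈ms : m ∈ pre ++ m ∷ suf
      m∈ms = ∈-++⁺ʳ pre (here refl)

      later∉pre : ∀ {x} → τ m < τ x → x ∉ pre
      later∉pre m<x x∈ = ℕ.<⇒≱ m<x (pre-≤ x∈)

      earlier∈pre : ∀ {x} → x ∈ pre ++ m ∷ suf → τ x < τ m → x ∈ pre
      earlier∈pre x∈ x<m with ∈-++⁻ pre x∈
      ... | inj₁ x∈pre             = x∈pre
      ... | inj₂ (here refl)       = ⊥-elim (ℕ.<-irrefl refl x<m)
      ... | inj₂ (there x∈suf)     = ⊥-elim (ℕ.<⇒≱ x<m (≤-suf x∈suf))

      rem∉pre : ∀ {u} → lookup K u ≡ false → rem u ∉ pre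
      rem∉pre Ku r∈ = true≢false (trans (sym (rem∈⇒K (∈-++⁺ˡ r∈))) Ku)

      add∉pre : ∀ {u} → lookup L u ≡ false → add u ∉ pre
      add∉pre Lu a∈ = true≢false (trans (sym (add∈⇒L (∈-++⁺ˡ a∈))) Lu)

      flips : ∀ m′ → m′ ≡ m → lookup (run pre K) (vertex m′) ≡ not (value m′)
      flips (rem v) refl = trans (lookup-run-untouched pre K v m∉pre (later∉pre (τ-rem<add v))) (rem∈⇒K m∈ms)
      flips (add v) refl with lookup K v in Kv
      ... | true  = lookup-run-removed pre K unique-pre (earlier∈pre (K⇒rem∈ Kv) (τ-rem<add v)) m∉pre
      ... | false = trans (lookup-run-untouched pre K v (rem∉pre Kv) m∉pre) Kv

      agreesK : ∀ u → τ m < τ (rem u) → lookup (run pre K) u ≡ lookup K u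
      agreesK u m<r = lookup-run-untouched pre K u (later∉pre m<r) (later∉pre (ℕ.<-trans m<r (τ-rem<add u)))

      agreesL : ∀ u → τ (add u) < τ m → lookup (run pre K) u ≡ lookup L u
      agreesL u a<m with lookup L u in Lu | lookup K u in Ku
      ... | true  | _     = lookup-run-added pre K unique-pre sorted-pre (earlier∈pre (L⇒add∈ Lu) a<m)
      ... | false | true  = lookup-run-removed pre K unique-pre (earlier∈pre (K⇒rem∈ Ku) (ℕ.<-trans (τ-rem<add u) a<m)) (add∉pre Lu)
      ... | false | false = trans (lookup-run-untouched pre K u (rem∉pre Ku) (add∉pre Lu)) Ku

-- Path decompositions and canonical paths

module _ where
  open import Data.Nat using (_≤_; _<_; _+_)

  double-< : ∀ {a b} → a < b → suc (a + a) < b + b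
  double-< {a} {b} a<b = subst (_≤ b + b) (cong suc (ℕ.+-suc a a)) (ℕ.+-mono-≤ a<b a<b)

  anyᶠ : ∀ {k} → (Fin k → Bool) → Bool
  anyᶠ {zero}  f = false
  anyᶠ {suc k} f = f zero ∨ anyᶠ (f ∘ suc)

  firstIndex lastIndex : ∀ {k} → (Fin k → Bool) → ℕ
  firstIndex {zero}  f = 0
  firstIndex {suc k} f = if f zero then 0 else suc (firstIndex (f ∘ suc))
  lastIndex  {zero}  f = 0
  lastIndex  {suc k} f = if anyᶠ (f ∘ suc) then suc (lastIndex (f ∘ suc)) else 0

  anyᶠ⁺ : ∀ {k} (f : Fin k → Bool) s → f s ≡ true → anyᶠ f ≡ true
  anyᶠ⁺ {suc k} f zero    fs rewrite fs = refl
  anyᶠ⁺ {suc k} f (suc s) fs with f zero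
  ... | true  = refl
  ... | false = anyᶠ⁺ (f ∘ suc) s fs

  anyᶠ⁻ : ∀ {k} (f : Fin k → Bool) → anyᶠ f ≡ true → ∃ λ s → f s ≡ true
  anyᶠ⁻ {suc k} f h with f zero in f0
  ... | true  = zero , f0
  ... | false = let s , fs = anyᶠ⁻ (f ∘ suc) h in suc s , fs

  firstIndex-≤ : ∀ {k} (f : Fin k → Bool) s → f s ≡ true → firstIndex f ≤ toℕ s
  firstIndex-≤ {suc k} f zero    fs rewrite fs = z≤n
  firstIndex-≤ {suc k} f (suc s) fs with f zero
  ... | true  = z≤n
  ... | false = s≤s (firstIndex-≤ (f ∘ suc) s fs)

  ≤-lastIndex : ∀ {k} (f : Fin k → Bool) s → f s ≡ true → toℕ s ≤ lastIndex f
  ≤-lastIndex {suc k} f zero    fs = z≤n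
  ≤-lastIndex {suc k} f (suc s) fs rewrite anyᶠ⁺ (f ∘ suc) s fs = s≤s (≤-lastIndex (f ∘ suc) s fs)

  firstIndex-true : ∀ {k} (f : Fin k → Bool) s → f s ≡ true → ∃ λ s′ → toℕ s′ ≡ firstIndex f × f s′ ≡ true
  firstIndex-true {suc k} f s fs with f zero in f0
  ... | true = zero , refl , f0
  firstIndex-true {suc k} f zero    fs | false = ⊥-elim (true≢false (trans (sym fs) f0))
  firstIndex-true {suc k} f (suc s) fs | false =
    let s′ , s′≡ , fs′ = firstIndex-true (f ∘ suc) s fs in suc s′ , cong suc s′≡ , fs′

  lastIndex-true : ∀ {k} (f : Fin k → Bool) s → f s ≡ true → ∃ λ s′ → toℕ s′ ≡ lastIndex f × f s′ ≡ true
  lastIndex-true {suc k} f s fs with anyᶠ (f ∘ suc) in any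
  ... | true = let s₀ , fs₀ = anyᶠ⁻ (f ∘ suc) any
                   s′ , s′≡ , fs′ = lastIndex-true (f ∘ suc) s₀ fs₀
               in suc s′ , cong suc s′≡ , fs′
  lastIndex-true {suc k} f zero    fs | false = zero , refl , fs
  lastIndex-true {suc k} f (suc s) fs | false = ⊥-elim (true≢false (trans (sym (anyᶠ⁺ (f ∘ suc) s fs)) any))

-- For the first bag, the empty last bag stands in for the previous one.
previous : ∀ {q} → Fin (suc q) → Fin (suc q)
previous {q} zero = fromℕ q
previous (suc s)  = inject₁ s

module PathDecomposition {n q : ℕ} (G : Graph n) (X : Fin (suc q) → Subset n)
                         (pd : IsPathDecomp G X) (X-last : X (fromℕ q) ≡ ∅) where
  open import Data.Nat using (_≤_; _<_; _+_; _<ᵇ_)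
  open IsPathDecomp pd
  open Schedule
  open import Data.List.Relation.Binary.Permutation.Setoid.Properties (setoid (Fin n)) using (Unique-resp-↭)

  first last : Fin n → ℕ
  first u = firstIndex (λ s → lookup (X s) u)
  last  u = lastIndex (λ s → lookup (X s) u)

  ∈X⇒first≤ : ∀ {u} s → lookup (X s) u ≡ true → first u ≤ toℕ s
  ∈X⇒first≤ {u} s = firstIndex-≤ (λ s → lookup (X s) u) s

  ∈X⇒≤last : ∀ {u} s → lookup (X s) u ≡ true → toℕ s ≤ last u
  ∈X⇒≤last {u} s = ≤-lastIndex (λ s → lookup (X s) u) s

  first-bag : ∀ u → ∃ λ s → toℕ s ≡ first u × lookup (X s) u ≡ true
  first-bag u = let s , u∈ = coverV u in firstIndex-true _ s u∈

  last-bag : ∀ u → ∃ λ s → toℕ s ≡ last u × lookup (X s) u ≡ true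
  last-bag u = let s , u∈ = coverV u in lastIndex-true _ s u∈

  first≤last : ∀ u → first u ≤ last u
  first≤last u = let s , s≡ , u∈ = first-bag u in subst (_≤ last u) s≡ (∈X⇒≤last s u∈)

  between⇒∈X : ∀ {u} s → first u ≤ toℕ s → toℕ s ≤ last u → lookup (X s) u ≡ true
  between⇒∈X {u} s first≤s s≤last =
    let a , a≡ , u∈a = first-bag u
        b , b≡ , u∈b = last-bag u
    in  interval u a s b (subst (_≤ toℕ s) (sym a≡) first≤s) (subst (toℕ s ≤_) (sym b≡) s≤last) u∈a u∈b

  <first⇒∉X : ∀ {u} s → toℕ s < first u → lookup (X s) u ≡ false
  <first⇒∉X {u} s s<first with lookup (X s) u in u∈
  ... | true  = ⊥-elim (ℕ.<⇒≱ s<first (∈X⇒first≤ s u∈))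
  ... | false = refl

  last<⇒∉X : ∀ {u} s → last u < toℕ s → lookup (X s) u ≡ false
  last<⇒∉X {u} s last<s with lookup (X s) u in u∈
  ... | true  = ⊥-elim (ℕ.<⇒≱ last<s (∈X⇒≤last s u∈))
  ... | false = refl

  last<q : ∀ u → last u < q
  last<q u with last-bag u
  ... | b , b≡ , u∈b with ℕ.m≤n⇒m<n∨m≡n (ℕ.s≤s⁻¹ (Fin.toℕ<n b))
  ... | inj₁ b<q = subst (_< q) b≡ b<q
  ... | inj₂ b≡q = ⊥-elim (true≢false (trans (sym u∈b) u∉b))
    where
      u∉b : lookup (X b) u ≡ false
      u∉b rewrite Fin.toℕ-injective {i = b} {j = fromℕ q} (trans b≡q (sym (Fin.toℕ-fromℕ q))) | X-last =
        Vec.lookup-replicate u false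

  ∈X-previous : ∀ {u} t → first u < toℕ t → toℕ t ≤ suc (last u) → lookup (X (previous t)) u ≡ true
  ∈X-previous {u} (suc s) first<t t≤last+1 =
    between⇒∈X (inject₁ s) (subst (first u ≤_) (sym (Fin.toℕ-inject₁ s)) (ℕ.s≤s⁻¹ first<t))
                           (subst (_≤ last u) (sym (Fin.toℕ-inject₁ s)) (ℕ.s≤s⁻¹ t≤last+1))

  ∉X-previous : ∀ {u} t → toℕ t ≤ first u ⊎ suc (last u) < toℕ t → lookup (X (previous t)) u ≡ false
  ∉X-previous {u} zero    _ = trans (cong (λ Y → lookup Y u) X-last) (Vec.lookup-replicate u false)
  ∉X-previous {u} (suc s) (inj₁ t≤first) = <first⇒∉X (inject₁ s) (subst (_< first u) (sym (Fin.toℕ-inject₁ s)) t≤first)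
  ∉X-previous {u} (suc s) (inj₂ last<t) = last<⇒∉X (inject₁ s) (subst (last u <_) (sym (Fin.toℕ-inject₁ s)) (ℕ.s≤s⁻¹ last<t))

  block : Move n → ℕ
  block (rem v) = first v
  block (add v) = suc (last v)

  bagOf : Move n → Fin (suc q)
  bagOf (rem v) = proj₁ (first-bag v)
  bagOf (add v) = suc (fromℕ< (last<q v))

  toℕ-bagOf : ∀ m → toℕ (bagOf m) ≡ block m
  toℕ-bagOf (rem v) = proj₁ (proj₂ (first-bag v))
  toℕ-bagOf (add v) = cong suc (Fin.toℕ-fromℕ< (last<q v))

  -- Removals of bag t get the time 2t, additions 2t+1, so a canonical path is sorted by time.
  τ : Move n → ℕ
  τ (rem v) = block (rem v) + block (rem v)
  τ (add v) = suc (block (add v) + block (add v))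

  τ-rem<add : ∀ u → τ (rem u) < τ (add u)
  τ-rem<add u = s≤s (ℕ.≤-trans (ℕ.+-mono-≤ (first≤last u) (first≤last u)) (ℕ.≤-trans (ℕ.+-monoʳ-≤ (last u) (ℕ.n≤1+n (last u))) (ℕ.n≤1+n _)))

  2block≤τ : ∀ m → block m + block m ≤ τ m
  2block≤τ (rem v) = ℕ.≤-refl
  2block≤τ (add v) = ℕ.n≤1+n _

  τ≤1+2block : ∀ m → τ m ≤ suc (block m + block m)
  τ≤1+2block (rem v) = ℕ.n≤1+n _
  τ≤1+2block (add v) = ℕ.≤-refl

  ∈-removeList⁻ : ∀ {K t v} → v ∈ removeList X K t → lookup K v ≡ true × first v ≡ toℕ t
  ∈-removeList⁻ {K} {t} {v} v∈ =
    let _ , selected = ∈-filterᵇ⁻ _ (allFin n) v∈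
        Kv , rest = ∧≡true⁻ selected
        v∈t , no-earlier = ∧≡true⁻ rest
    in  Kv , ℕ.≤-antisym (∈X⇒first≤ t v∈t) (ℕ.≮⇒≥ (first<t⇒earlier (not≡true⁻ no-earlier)))
    where
      first<t⇒earlier : any (λ j → (toℕ j <ᵇ toℕ t) ∧ lookup (X j) v) (allFin (suc q)) ≡ false → ¬ first v < toℕ t
      first<t⇒earlier none first<t =
        let s , s≡ , v∈s = first-bag v
        in  true≢false (trans (sym (any≡true⁺ _ (∈-allFin s) (earlier s s≡ v∈s first<t))) none)
        where
          earlier : ∀ s → toℕ s ≡ first v → lookup (X s) v ≡ true → first v < toℕ t → ((toℕ s <ᵇ toℕ t) ∧ lookup (X s) v) ≡ true
          earlier s s≡ v∈s first<t rewrite T-≡ .to (ℕ.<⇒<ᵇ (subst (_< toℕ t) (sym s≡) first<t)) | v∈s = refl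

  ∈-removeList⁺ : ∀ {K t v} → lookup K v ≡ true → toℕ t ≡ first v → v ∈ removeList X K t
  ∈-removeList⁺ {K} {t} {v} Kv t≡first = ∈-filterᵇ⁺ _ (∈-allFin v) selected
    where
      no-earlier : any (λ j → (toℕ j <ᵇ toℕ t) ∧ lookup (X j) v) (allFin (suc q)) ≡ false
      no-earlier with any (λ j → (toℕ j <ᵇ toℕ t) ∧ lookup (X j) v) (allFin (suc q)) in found
      ... | false = refl
      ... | true  = let j , _ , j-ok = any≡true⁻ _ (allFin (suc q)) found
                        j<t , v∈j = ∧≡true⁻ j-ok
                    in  ⊥-elim (ℕ.<⇒≱ (subst (toℕ j <_) t≡first (ℕ.<ᵇ⇒< _ _ (T-≡ .from j<t))) (∈X⇒first≤ j v∈j))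
      selected : (lookup K v ∧ lookup (X t) v ∧ not (any (λ j → (toℕ j <ᵇ toℕ t) ∧ lookup (X j) v) (allFin (suc q)))) ≡ true
      selected rewrite Kv | no-earlier
                     | between⇒∈X {v} t (ℕ.≤-reflexive (sym t≡first)) (subst (_≤ last v) (sym t≡first) (first≤last v)) = refl

  ∈-addList⁻ : ∀ {L t v} → v ∈ addList X L t → lookup L v ≡ true × block (add v) ≡ toℕ t
  ∈-addList⁻ {t = zero} ()
  ∈-addList⁻ {L} {suc s} {v} v∈ =
    let _ , selected = ∈-filterᵇ⁻ _ (allFin n) v∈
        Lv , rest = ∧≡true⁻ selected
        v∈s , v∉s+1 = ∧≡true⁻ rest
        s≤last = subst (_≤ last v) (Fin.toℕ-inject₁ s) (∈X⇒≤last (inject₁ s) v∈s)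
        first≤s = subst (first v ≤_) (Fin.toℕ-inject₁ s) (∈X⇒first≤ (inject₁ s) v∈s)
        last≤s = ℕ.≮⇒≥ (λ s<last → true≢false (trans (sym (between⇒∈X (suc s) (ℕ.m≤n⇒m≤1+n first≤s) s<last)) (not≡true⁻ v∉s+1)))
    in  Lv , cong suc (ℕ.≤-antisym last≤s s≤last)

  ∈-addList⁺ : ∀ {L v} → lookup L v ≡ true → v ∈ addList X L (bagOf (add v))
  ∈-addList⁺ {L} {v} Lv = ∈-filterᵇ⁺ _ (∈-allFin v) selected
    where
      s = fromℕ< (last<q v)
      s≡last : toℕ (inject₁ s) ≡ last v
      s≡last = trans (Fin.toℕ-inject₁ s) (Fin.toℕ-fromℕ< (last<q v))
      selected : (lookup L v ∧ lookup (X (inject₁ s)) v ∧ not (lookup (X (suc s)) v)) ≡ true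
      selected rewrite Lv
                     | between⇒∈X {v} (inject₁ s) (subst (first v ≤_) (sym s≡last) (first≤last v)) (ℕ.≤-reflexive s≡last)
                     | last<⇒∉X {v} (suc s) (s≤s (ℕ.≤-reflexive (sym (Fin.toℕ-fromℕ< (last<q v))))) = refl

  present : Subset n → Subset n → Move n → Set
  present K L (rem v) = lookup K v ≡ true
  present K L (add v) = lookup L v ≡ true

  module Canonical {K L : Subset n} (R A : Fin (suc q) → List (Fin n))
                   (R↭ : ∀ t → R t ↭ removeList X K t) (A↭ : ∀ t → A t ↭ addList X L t) where

    moves : Fin (suc q) → List (Move n)
    moves t = map rem (R t) ++ map add (A t)

    path : List (Move n)
    path = concat (map moves (allFin (suc q)))

    ∈-moves⁻ : ∀ {t m} → m ∈ moves t → block m ≡ toℕ t × present K L m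
    ∈-moves⁻ {t} m∈ with ∈-++⁻ (map rem (R t)) m∈
    ... | inj₁ r∈ with ∈-map⁻ rem r∈
    ...   | v , v∈ , refl = let Kv , first≡t = ∈-removeList⁻ {K} (∈-resp-↭ (R↭ t) v∈) in first≡t , Kv
    ∈-moves⁻ {t} m∈ | inj₂ a∈ with ∈-map⁻ add a∈
    ...   | v , v∈ , refl = let Lv , block≡t = ∈-addList⁻ {L} (∈-resp-↭ (A↭ t) v∈) in block≡t , Lv

    ∈-moves⁺ : ∀ m → present K L m → m ∈ moves (bagOf m)
    ∈-moves⁺ (rem v) Kv =
      ∈-++⁺ˡ (∈-map⁺ rem (∈-resp-↭ (↭-sym (R↭ _)) (∈-removeList⁺ {K} Kv (toℕ-bagOf (rem v)))))
    ∈-moves⁺ (add v) Lv =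
      ∈-++⁺ʳ (map rem (R _)) (∈-map⁺ add (∈-resp-↭ (↭-sym (A↭ _)) (∈-addList⁺ {L} Lv)))

    ∈-path⁻ : ∀ {m} → m ∈ path → present K L m
    ∈-path⁻ m∈ with ∈-concat⁻′ (map moves (allFin (suc q))) m∈
    ... | ms , m∈ms , ms∈ with ∈-map⁻ moves ms∈
    ... | t , _ , refl = proj₂ (∈-moves⁻ m∈ms)

    ∈-path⁺ : ∀ m → present K L m → m ∈ path
    ∈-path⁺ m pm = ∈-concat⁺′ (∈-moves⁺ m pm) (∈-map⁺ moves (∈-allFin (bagOf m)))

    τ-moves : ∀ {t m} → m ∈ moves t → toℕ t + toℕ t ≤ τ m × τ m ≤ suc (toℕ t + toℕ t)
    τ-moves {t} {m} m∈ rewrite sym (proj₁ (∈-moves⁻ m∈)) = 2block≤τ m , τ≤1+2block m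

    τ-moves-< : ∀ {i j} → i Fin.< j → ∀ {x y} → x ∈ moves i → y ∈ moves j → τ x < τ y
    τ-moves-< i<j x∈ y∈ = ℕ.<-≤-trans (s≤s (proj₂ (τ-moves x∈))) (ℕ.≤-trans (double-< i<j) (proj₁ (τ-moves y∈)))

    sorted-const : ∀ {ms} c → (∀ {m} → m ∈ ms → τ m ≡ c) → AllPairs (λ m m′ → τ m ≤ τ m′) ms
    sorted-const {[]}     c τ≡c = []
    sorted-const {m ∷ ms} c τ≡c =
      All.tabulate (λ m′∈ → ℕ.≤-reflexive (trans (τ≡c (here refl)) (sym (τ≡c (there m′∈))))) ∷ sorted-const c (τ≡c ∘ there)

    moves-sorted : ∀ t → AllPairs (λ m m′ → τ m ≤ τ m′) (moves t)
    moves-sorted t = AllPairs.++⁺ (sorted-const (toℕ t + toℕ t) τ-rem) (sorted-const (suc (toℕ t + toℕ t)) τ-add)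
                       (All.tabulate λ r∈ → All.tabulate λ a∈ → ℕ.≤-trans (ℕ.≤-reflexive (τ-rem r∈)) (ℕ.≤-trans (ℕ.n≤1+n _) (ℕ.≤-reflexive (sym (τ-add a∈)))))
      where
        τ-rem : ∀ {m} → m ∈ map rem (R t) → τ m ≡ toℕ t + toℕ t
        τ-rem r∈ with ∈-map⁻ rem r∈
        ... | v , _ , refl = cong (λ b → b + b) (proj₁ (∈-moves⁻ {t} (∈-++⁺ˡ r∈)))
        τ-add : ∀ {m} → m ∈ map add (A t) → τ m ≡ suc (toℕ t + toℕ t)
        τ-add a∈ with ∈-map⁻ add a∈
        ... | v , _ , refl = cong (λ b → suc (b + b)) (proj₁ (∈-moves⁻ {t} (∈-++⁺ʳ (map rem (R t)) a∈)))

    path-sorted : AllPairs (λ m m′ → τ m ≤ τ m′) path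
    path-sorted = AllPairs.concat⁺ (AllP.map⁺ (All.tabulate λ {t} _ → moves-sorted t))
      (AllPairs.map⁺ (AllPairs.tabulate⁺-< λ i<j → All.tabulate λ x∈ → All.tabulate λ y∈ → ℕ.<⇒≤ (τ-moves-< i<j x∈ y∈)))

    moves-unique : ∀ t → Unique (moves t)
    moves-unique t = Unique.++⁺ (Unique.map⁺ rem-injective (unique-↭ (R↭ t) (Unique.filter⁺ _ (Unique.allFin⁺ n))))
                                (Unique.map⁺ add-injective (unique-↭ (A↭ t) (addList-unique t)))
                                rem≢add
      where
        unique-↭ : ∀ {xs ys : List (Fin n)} → xs ↭ ys → Unique ys → Unique xs
        unique-↭ p = Unique-resp-↭ (↭⇒↭ₛ (↭-sym p))
        addList-unique : ∀ t → Unique (addList X L t)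
        addList-unique zero    = []
        addList-unique (suc s) = Unique.filter⁺ _ (Unique.allFin⁺ n)
        rem-injective : ∀ {u v} → rem u ≡ rem v → u ≡ v
        rem-injective refl = refl
        add-injective : ∀ {u v} → add u ≡ add v → u ≡ v
        add-injective refl = refl
        rem≢add : ∀ {m} → ¬ (m ∈ map rem (R t) × m ∈ map add (A t))
        rem≢add (r∈ , a∈) with ∈-map⁻ rem r∈ | ∈-map⁻ add a∈
        ... | _ , _ , refl | _ , _ , ()

    path-unique : Unique path
    path-unique = Unique.concat⁺ (AllP.map⁺ (All.tabulate λ {t} _ → moves-unique t))
      (AllPairs.map⁺ (AllPairs.tabulate⁺-< λ i<j (x∈ , y∈) → ℕ.<-irrefl refl (τ-moves-< i<j x∈ y∈)))

    isSchedule : IsSchedule τ τ-rem<add K L path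
    isSchedule = record
      { sorted = path-sorted ; unique = path-unique
      ; rem∈⇒K = ∈-path⁻ ; K⇒rem∈ = ∈-path⁺ (rem _) ; add∈⇒L = ∈-path⁻ ; L⇒add∈ = ∈-path⁺ (add _) }

  canonical⇒schedule : ∀ {K L ms} → IsCanonical X K L ms → IsSchedule τ τ-rem<add K L ms
  canonical⇒schedule (R , A , R↭ , A↭ , refl) = Canonical.isSchedule R A R↭ A↭

-- Encoding the pairs of independent sets at a bag

module AtBag {n q : ℕ} (G : Graph n) (X : Fin (suc q) → Subset n)
             (pd : IsPathDecomp G X) (X-last : X (fromℕ q) ≡ ∅) (t : Fin (suc q)) (W : Subset n) where
  open import Data.Nat using (_≤_; _<_; _+_)
  open PathDecomposition G X pd X-last
  open IsPathDecomp pd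

  t⁻ : Fin (suc q)
  t⁻ = previous t

  data Region (u : Fin n) : Set where
    gone     : suc (last u) < toℕ t → Region u
    leaving  : suc (last u) ≡ toℕ t → Region u
    staying  : first u < toℕ t → toℕ t ≤ last u → Region u
    entering : first u ≡ toℕ t → Region u
    future   : toℕ t < first u → Region u

  region : ∀ u → Region u
  region u with ℕ.<-cmp (suc (last u)) (toℕ t)
  ... | tri< gone′ _ _ = gone gone′
  ... | tri≈ _ left _  = leaving left
  ... | tri> _ _ t≤last with ℕ.<-cmp (first u) (toℕ t)
  ...   | tri< first<t _ _ = staying first<t (ℕ.s≤s⁻¹ t≤last)
  ...   | tri≈ _ first≡t _ = entering first≡t
  ...   | tri> _ _ t<first = future t<first

  inX inX⁻ : ∀ {u} → Region u → Bool
  inX (staying _ _) = true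
  inX (entering _)  = true
  inX _             = false
  inX⁻ (leaving _)   = true
  inX⁻ (staying _ _) = true
  inX⁻ _             = false

  X-region : ∀ {u} (r : Region u) → lookup (X t) u ≡ inX r
  X-region (gone last+1<t)        = last<⇒∉X t (ℕ.<-trans (ℕ.n<1+n _) last+1<t)
  X-region (leaving last+1≡t)     = last<⇒∉X t (subst (_ <_) last+1≡t (ℕ.n<1+n _))
  X-region (staying first<t t≤last) = between⇒∈X t (ℕ.<⇒≤ first<t) t≤last
  X-region {u} (entering first≡t) = between⇒∈X t (ℕ.≤-reflexive first≡t) (subst (_≤ last u) first≡t (first≤last u))
  X-region (future t<first)       = <first⇒∉X t t<first

  X⁻-region : ∀ {u} (r : Region u) → lookup (X t⁻) u ≡ inX⁻ r
  X⁻-region (gone last+1<t)        = ∉X-previous t (inj₂ last+1<t)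
  X⁻-region {u} (leaving last+1≡t) = ∈X-previous t (subst (first u <_) last+1≡t (s≤s (first≤last u))) (ℕ.≤-reflexive (sym last+1≡t))
  X⁻-region (staying first<t t≤last) = ∈X-previous t first<t (ℕ.m≤n⇒m≤1+n t≤last)
  X⁻-region (entering first≡t)     = ∉X-previous t (inj₁ (ℕ.≤-reflexive (sym first≡t)))
  X⁻-region (future t<first)       = ∉X-previous t (inj₁ (ℕ.<⇒≤ t<first))

  Compatible : Subset n → Subset n → Set
  Compatible K L = (∀ u → toℕ t < first u → lookup W u ≡ lookup K u)
                 × (∀ u → suc (last u) < toℕ t → lookup W u ≡ lookup L u)

  step⇒Compatible : ∀ {K L W′} (st : Schedule.Step τ τ-rem<add K L W W′) → block (Schedule.Step.move st) ≡ toℕ t → Compatible K L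
  step⇒Compatible st block≡t =
      (λ u t<first → agreesK u (ℕ.≤-<-trans (τ≤1+2block move) (subst (λ b → suc (b + b) < τ (rem u)) (sym block≡t) (double-< t<first))))
    , (λ u last+1<t → agreesL u (ℕ.<-≤-trans (double-< last+1<t) (subst (λ b → b + b ≤ τ move) block≡t (2block≤τ move))))
    where open Schedule.Step st

  ηᵇ : ∀ {u} → Region u → Bool → Bool → Bool
  ηᵇ (gone _)      k l = k
  ηᵇ (leaving _)   k l = k
  ηᵇ (staying _ _) k l = false
  ηᵇ (entering _)  k l = l
  ηᵇ (future _)    k l = l

  η : Subset n → Subset n → Subset n
  η K L = tabulate λ u → ηᵇ (region u) (lookup K u) (lookup L u)

  lookup-η : ∀ K L u → lookup (η K L) u ≡ ηᵇ (region u) (lookup K u) (lookup L u)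
  lookup-η K L u = Vec.lookup∘tabulate _ u

  ηᵇ≡true⁻ : ∀ {u} (r : Region u) k l → ηᵇ r k l ≡ true → (last u < toℕ t × k ≡ true) ⊎ (toℕ t ≤ first u × l ≡ true)
  ηᵇ≡true⁻ (gone last+1<t)    k l k≡ = inj₁ (ℕ.<-trans (ℕ.n<1+n _) last+1<t , k≡)
  ηᵇ≡true⁻ (leaving last+1≡t) k l k≡ = inj₁ (subst (_ <_) last+1≡t (ℕ.n<1+n _) , k≡)
  ηᵇ≡true⁻ (entering first≡t) k l l≡ = inj₂ (ℕ.≤-reflexive (sym first≡t) , l≡)
  ηᵇ≡true⁻ (future t<first)   k l l≡ = inj₂ (ℕ.<⇒≤ t<first , l≡)

  nonadjacent-across : ∀ {u v} → last u < toℕ t → toℕ t ≤ first v → adj G u v ≡ false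
  nonadjacent-across {u} {v} last<t t≤first with adj G u v in uv
  ... | false = refl
  ... | true  = let s , u∈s , v∈s = coverE u v uv
                in  ⊥-elim (ℕ.<⇒≱ (ℕ.≤-<-trans (∈X⇒≤last s u∈s) last<t) (ℕ.≤-trans t≤first (∈X⇒first≤ s v∈s)))

  η-indep : ∀ {K L} → Indep G K → Indep G L → Indep G (η K L)
  η-indep {K} {L} K-indep L-indep = nonadjacent⇒Indep G (η K L) λ u v ηu ηv →
    nonadjacent (ηᵇ≡true⁻ (region u) _ _ (trans (sym (lookup-η K L u)) ηu)) (ηᵇ≡true⁻ (region v) _ _ (trans (sym (lookup-η K L v)) ηv))
    where
      nonadjacent : ∀ {u v} → (last u < toℕ t × lookup K u ≡ true) ⊎ (toℕ t ≤ first u × lookup L u ≡ true)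
                            → (last v < toℕ t × lookup K v ≡ true) ⊎ (toℕ t ≤ first v × lookup L v ≡ true)
                            → adj G u v ≡ false
      nonadjacent {u} {v} (inj₁ (_ , Ku)) (inj₁ (_ , Kv)) = Indep⇒nonadjacent G K K-indep u v Ku Kv
      nonadjacent {u} {v} (inj₂ (_ , Lu)) (inj₂ (_ , Lv)) = Indep⇒nonadjacent G L L-indep u v Lu Lv
      nonadjacent (inj₁ (last<t , _)) (inj₂ (t≤first , _)) = nonadjacent-across last<t t≤first
      nonadjacent {u} {v} (inj₂ (t≤first , _)) (inj₁ (last<t , _)) = trans (Graph.sym G u v) (nonadjacent-across last<t t≤first)

  φ : Subset n × Subset n → Subset n × (Subset n × Subset n)
  φ (K , L) = η K L , X t ∩ K , X t⁻ ∩ L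

  determined : ∀ {u} (r : Region u) {k l k′ l′ w} →
               (toℕ t < first u → w ≡ k) → (toℕ t < first u → w ≡ k′) →
               (suc (last u) < toℕ t → w ≡ l) → (suc (last u) < toℕ t → w ≡ l′) →
               ηᵇ r k l ≡ ηᵇ r k′ l′ → inX r ∧ k ≡ inX r ∧ k′ → inX⁻ r ∧ l ≡ inX⁻ r ∧ l′ → k ≡ k′ × l ≡ l′
  determined (gone p)      _  _   wl wl′ η≡ _  _  = η≡ , trans (sym (wl p)) (wl′ p)
  determined (leaving _)   _  _   _  _   η≡ _  T≡ = η≡ , T≡
  determined (staying _ _) _  _   _  _   _  S≡ T≡ = S≡ , T≡
  determined (entering _)  _  _   _  _   η≡ S≡ _  = S≡ , η≡
  determined (future p)    wk wk′ _  _   η≡ _  _  = trans (sym (wk p)) (wk′ p) , η≡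

  φ-injective : ∀ {K L K′ L′} → Compatible K L → Compatible K′ L′ → φ (K , L) ≡ φ (K′ , L′) → (K , L) ≡ (K′ , L′)
  φ-injective {K} {L} {K′} {L′} (WK , WL) (WK′ , WL′) φ≡ =
    cong₂ _,_ (Subset-ext (λ u → proj₁ (at u))) (Subset-ext (λ u → proj₂ (at u)))
    where
      same : ∀ (S S′ : Subset n) (Y : Fin (suc q)) u → X Y ∩ S ≡ X Y ∩ S′ → lookup (X Y) u ∧ lookup S u ≡ lookup (X Y) u ∧ lookup S′ u
      same S S′ Y u eq = trans (sym (lookup-∩ (X Y) S u)) (trans (cong (λ Z → lookup Z u) eq) (lookup-∩ (X Y) S′ u))
      at : ∀ u → lookup K u ≡ lookup K′ u × lookup L u ≡ lookup L′ u
      at u = determined (region u) (WK u) (WK′ u) (WL u) (WL′ u)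
        (trans (sym (lookup-η K L u)) (trans (cong (λ p → lookup (proj₁ p) u) φ≡) (lookup-η K′ L′ u)))
        (subst (λ b → b ∧ lookup K u ≡ b ∧ lookup K′ u) (X-region (region u)) (same K K′ t u (cong (proj₁ ∘ proj₂) φ≡)))
        (subst (λ b → b ∧ lookup L u ≡ b ∧ lookup L′ u) (X⁻-region (region u)) (same L L′ t⁻ u (cong (proj₂ ∘ proj₂) φ≡)))

  Wᵗ : Subset n
  Wᵗ = (X t ∪ X t⁻) ∩ W

  ∣Wᵗ∣≤ : ∣ Wᵗ ∣ˢ ≤ ∣ X t ∩ W ∣ˢ + ∣ X t⁻ ∩ W ∣ˢ
  ∣Wᵗ∣≤ rewrite Subset.∩-distribʳ-∪ W (X t) (X t⁻) = ∣∪∣≤∣∣+∣∣ (X t ∩ W) (X t⁻ ∩ W)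

  multiplicity-identity : ∀ {u} (r : Region u) k l w → (toℕ t < first u → w ≡ k) → (suc (last u) < toℕ t → w ≡ l) →
    bit k + (bit l + (bit ((inX r ∨ inX⁻ r) ∧ w) + 0)) ≡ bit (ηᵇ r k l) + (bit w + (bit (inX r ∧ k) + (bit (inX⁻ r ∧ l) + 0)))
  multiplicity-identity (gone p)      k l w _  wl rewrite wl p = refl
  multiplicity-identity (leaving _)   k l w _  _  = rearrange (bit k) (bit l) (bit w)
    where rearrange : ∀ a b c → a + (b + (c + 0)) ≡ a + (c + (b + 0))
          rearrange = solve-∀
  multiplicity-identity (staying _ _) k l w _  _  = rearrange (bit k) (bit l) (bit w)
    where rearrange : ∀ a b c → a + (b + (c + 0)) ≡ c + (a + (b + 0))
          rearrange = solve-∀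
  multiplicity-identity (entering _)  k l w _  _  = rearrange (bit k) (bit l) (bit w)
    where rearrange : ∀ a b c → a + (b + (c + 0)) ≡ b + (c + (a + 0))
          rearrange = solve-∀
  multiplicity-identity (future p)    k l w wk _  rewrite wk p = rearrange (bit k) (bit l)
    where rearrange : ∀ a b → a + (b + 0) ≡ b + (a + 0)
          rearrange = solve-∀

  size-identity : ∀ {K L} → Compatible K L → ∣ K ∣ˢ + ∣ L ∣ˢ + ∣ Wᵗ ∣ˢ ≡ ∣ η K L ∣ˢ + ∣ W ∣ˢ + (∣ X t ∩ K ∣ˢ + ∣ X t⁻ ∩ L ∣ˢ)
  size-identity {K} {L} (WK , WL) = begin
    ∣ K ∣ˢ + ∣ L ∣ˢ + ∣ Wᵗ ∣ˢ                                   ≡⟨ assoc₃ ∣ K ∣ˢ ∣ L ∣ˢ ∣ Wᵗ ∣ˢ ⟩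
    sum (map ∣_∣ˢ (K ∷ L ∷ Wᵗ ∷ []))                            ≡⟨ double-counting (K ∷ L ∷ Wᵗ ∷ []) (η K L ∷ W ∷ X t ∩ K ∷ X t⁻ ∩ L ∷ []) at ⟩
    sum (map ∣_∣ˢ (η K L ∷ W ∷ X t ∩ K ∷ X t⁻ ∩ L ∷ []))        ≡⟨ assoc₄ ∣ η K L ∣ˢ ∣ W ∣ˢ ∣ X t ∩ K ∣ˢ ∣ X t⁻ ∩ L ∣ˢ ⟨
    ∣ η K L ∣ˢ + ∣ W ∣ˢ + (∣ X t ∩ K ∣ˢ + ∣ X t⁻ ∩ L ∣ˢ)        ∎
    where
      open ≡-Reasoning
      assoc₃ : ∀ a b c → a + b + c ≡ a + (b + (c + 0))
      assoc₃ = solve-∀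
      assoc₄ : ∀ a b c d → a + b + (c + d) ≡ a + (b + (c + (d + 0)))
      assoc₄ = solve-∀
      at : ∀ u → multiplicity u (K ∷ L ∷ Wᵗ ∷ []) ≡ multiplicity u (η K L ∷ W ∷ X t ∩ K ∷ X t⁻ ∩ L ∷ [])
      at u rewrite lookup-∩ (X t ∪ X t⁻) W u | Vec.lookup-zipWith _∨_ u (X t) (X t⁻) | lookup-∩ (X t) K u | lookup-∩ (X t⁻) L u
                 | X-region (region u) | X⁻-region (region u) | lookup-η K L u =
        multiplicity-identity (region u) (lookup K u) (lookup L u) (lookup W u) (WK u) (WL u)

open import Data.Rational as ℚ using (ℚ; mkℚ; 0ℚ; 1ℚ; _+_; _*_; _≤_; _<_; _⊔_; _≟_; 1/_)
open import Data.Rational.Properties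
open import Data.Rational.Solver using (module +-*-Solver)
open +-*-Solver using (solve; _:+_; _:*_; _:=_; con)

0<1 : 0ℚ < 1ℚ
0<1 = positive⁻¹ 1ℚ

*-monoˡ-≤ : ∀ {r p q} → 0ℚ ≤ r → p ≤ q → r * p ≤ r * q
*-monoˡ-≤ {r} 0≤r = *-monoˡ-≤-nonNeg r {{ℚ.nonNegative 0≤r}}

*-monoʳ-≤ : ∀ {r p q} → 0ℚ ≤ r → p ≤ q → p * r ≤ q * r
*-monoʳ-≤ {r} 0≤r = *-monoʳ-≤-nonNeg r {{ℚ.nonNegative 0≤r}}

*-mono-≤ : ∀ {p q r s} → 0ℚ ≤ q → 0ℚ ≤ r → p ≤ q → r ≤ s → p * r ≤ q * s
*-mono-≤ 0≤q 0≤r p≤q r≤s = ≤-trans (*-monoʳ-≤ 0≤r p≤q) (*-monoˡ-≤ 0≤q r≤s)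

*-nonNeg : ∀ {p q} → 0ℚ ≤ p → 0ℚ ≤ q → 0ℚ ≤ p * q
*-nonNeg {p} 0≤p 0≤q = ≤-trans (≤-reflexive (sym (*-zeroʳ p))) (*-monoˡ-≤ 0≤p 0≤q)

*-pos : ∀ {p q} → 0ℚ < p → 0ℚ < q → 0ℚ < p * q
*-pos {p} {q} 0<p 0<q = positive⁻¹ (p * q) {{pos*pos⇒pos p {{ℚ.positive 0<p}} q {{ℚ.positive 0<q}}}}

inv≡1/ : ∀ p (0<p : 0ℚ < p) → inv p ≡ (1/ p) {{pos⇒nonZero p {{ℚ.positive 0<p}}}}
inv≡1/ p 0<p with p ≟ 0ℚ
... | yes refl = ⊥-elim (<-irrefl refl 0<p)
... | no _     = refl

0<inv : ∀ {p} → 0ℚ < p → 0ℚ < inv p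
0<inv {p} 0<p rewrite inv≡1/ p 0<p = positive⁻¹ _ {{1/pos⇒pos p {{ℚ.positive 0<p}}}}

*-inv : ∀ {p} → 0ℚ < p → p * inv p ≡ 1ℚ
*-inv {p} 0<p rewrite inv≡1/ p 0<p = *-inverseʳ p {{pos⇒nonZero p {{ℚ.positive 0<p}}}}

inv-* : ∀ {p} → 0ℚ < p → inv p * p ≡ 1ℚ
inv-* {p} 0<p = trans (*-comm (inv p) p) (*-inv 0<p)

≤*⇒inv*≤ : ∀ {x s b} → 0ℚ < x → s ≤ x * b → inv x * s ≤ b
≤*⇒inv*≤ {x} {s} {b} 0<x s≤xb = begin
  inv x * s       ≤⟨ *-monoˡ-≤ (<⇒≤ (0<inv 0<x)) s≤xb ⟩
  inv x * (x * b) ≡⟨ *-assoc (inv x) x b ⟨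
  inv x * x * b   ≡⟨ cong (_* b) (inv-* 0<x) ⟩
  1ℚ * b          ≡⟨ *-identityˡ b ⟩
  b               ∎
  where open ≤-Reasoning

1≤inv : ∀ {p} → 0ℚ < p → p ≤ 1ℚ → 1ℚ ≤ inv p
1≤inv {p} 0<p p≤1 = begin
  1ℚ         ≡⟨ *-inv 0<p ⟨
  p * inv p  ≤⟨ *-monoʳ-≤ (<⇒≤ (0<inv 0<p)) p≤1 ⟩
  1ℚ * inv p ≡⟨ *-identityˡ (inv p) ⟩
  inv p      ∎
  where open ≤-Reasoning

ℕtoℚ≡mkℚ : ∀ k → ℕtoℚ k ≡ mkℚ (ℤ.+ k) 0 (Coprime.sym (Coprime.1-coprimeTo k))
ℕtoℚ≡mkℚ k = ↥p/↧p≡p _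

ℕtoℚ-+ : ∀ a b → ℕtoℚ (a ℕ.+ b) ≡ ℕtoℚ a + ℕtoℚ b
ℕtoℚ-+ a b rewrite ℕtoℚ≡mkℚ a | ℕtoℚ≡mkℚ b =
  cong (ℚ._/ 1) (sym (cong₂ ℤ._+_ (ℤ.*-identityʳ (ℤ.+ a)) (ℤ.*-identityʳ (ℤ.+ b))))

ℕtoℚ-* : ∀ a b → ℕtoℚ (a ℕ.* b) ≡ ℕtoℚ a * ℕtoℚ b
ℕtoℚ-* a b rewrite ℕtoℚ≡mkℚ a | ℕtoℚ≡mkℚ b = cong (ℚ._/ 1) (ℤ.pos-* a b)

ℕtoℚ-mono-≤ : ∀ {a b} → a ℕ.≤ b → ℕtoℚ a ≤ ℕtoℚ b
ℕtoℚ-mono-≤ {a} {b} a≤b rewrite ℕtoℚ≡mkℚ a | ℕtoℚ≡mkℚ b =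
  ℚ.*≤* (subst₂ ℤ._≤_ (sym (ℤ.*-identityʳ (ℤ.+ a))) (sym (ℤ.*-identityʳ (ℤ.+ b))) (ℤ.+≤+ a≤b))

ℕtoℚ-nonNeg : ∀ a → 0ℚ ≤ ℕtoℚ a
ℕtoℚ-nonNeg a = ℕtoℚ-mono-≤ {0} {a} ℕ.z≤n

ℕtoℚ-pos : ∀ a → 0 ℕ.< a → 0ℚ < ℕtoℚ a
ℕtoℚ-pos (suc a) _ rewrite ℕtoℚ≡mkℚ (suc a) = ℚ.*<* (ℤ.+<+ (ℕ.s≤s ℕ.z≤n))

^ℚ-distribˡ-+-* : ∀ x a b → x ^ℚ (a ℕ.+ b) ≡ x ^ℚ a * x ^ℚ b
^ℚ-distribˡ-+-* x zero    b = sym (*-identityˡ _)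
^ℚ-distribˡ-+-* x (suc a) b rewrite ^ℚ-distribˡ-+-* x a b = sym (*-assoc x _ _)

^ℚ-distribʳ-* : ∀ x y k → (x * y) ^ℚ k ≡ x ^ℚ k * y ^ℚ k
^ℚ-distribʳ-* x y zero    = refl
^ℚ-distribʳ-* x y (suc k) rewrite ^ℚ-distribʳ-* x y k =
  solve 4 (λ a b c d → (a :* b) :* (c :* d) := (a :* c) :* (b :* d)) refl x y (x ^ℚ k) (y ^ℚ k)

1^ℚ : ∀ k → 1ℚ ^ℚ k ≡ 1ℚ
1^ℚ zero    = refl
1^ℚ (suc k) rewrite 1^ℚ k = refl

^ℚ-pos : ∀ {x} k → 0ℚ < x → 0ℚ < x ^ℚ k
^ℚ-pos zero    0<x = 0<1
^ℚ-pos (suc k) 0<x = *-pos 0<x (^ℚ-pos k 0<x)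

^ℚ-nonNeg : ∀ {x} k → 0ℚ ≤ x → 0ℚ ≤ x ^ℚ k
^ℚ-nonNeg zero    0≤x = <⇒≤ 0<1
^ℚ-nonNeg (suc k) 0≤x = *-nonNeg 0≤x (^ℚ-nonNeg k 0≤x)

^ℚ-monoˡ-≤ : ∀ {x y} k → 0ℚ ≤ x → x ≤ y → x ^ℚ k ≤ y ^ℚ k
^ℚ-monoˡ-≤ zero    0≤x x≤y = ≤-refl
^ℚ-monoˡ-≤ (suc k) 0≤x x≤y = *-mono-≤ (≤-trans 0≤x x≤y) (^ℚ-nonNeg k 0≤x) x≤y (^ℚ-monoˡ-≤ k 0≤x x≤y)

^ℚ-monoʳ-≤ : ∀ {x a b} → 1ℚ ≤ x → a ℕ.≤ b → x ^ℚ a ≤ x ^ℚ b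
^ℚ-monoʳ-≤ {b = b} 1≤x ℕ.z≤n = ≤-trans (≤-reflexive (sym (1^ℚ b))) (^ℚ-monoˡ-≤ b (<⇒≤ 0<1) 1≤x)
^ℚ-monoʳ-≤ {x} 1≤x (ℕ.s≤s a≤b) = *-monoˡ-≤ (≤-trans (<⇒≤ 0<1) 1≤x) (^ℚ-monoʳ-≤ 1≤x a≤b)

^ℚ-≤1 : ∀ {x} k → 0ℚ ≤ x → x ≤ 1ℚ → x ^ℚ k ≤ 1ℚ
^ℚ-≤1 {x} k 0≤x x≤1 = ≤-trans (^ℚ-monoˡ-≤ k 0≤x x≤1) (≤-reflexive (1^ℚ k))

Λ : ℚ → ℚ
Λ lam = lam ⊔ inv lam

lam≤Λ : ∀ lam → lam ≤ Λ lam
lam≤Λ lam = p≤p⊔q lam (inv lam)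

inv≤Λ : ∀ lam → inv lam ≤ Λ lam
inv≤Λ lam = p≤q⊔p lam (inv lam)

1≤Λ : ∀ {lam} → 0ℚ < lam → 1ℚ ≤ Λ lam
1≤Λ {lam} 0<lam with ≤-total 1ℚ lam
... | inj₁ 1≤lam = ≤-trans 1≤lam (lam≤Λ lam)
... | inj₂ lam≤1 = ≤-trans (1≤inv 0<lam lam≤1) (inv≤Λ lam)

0≤Λ : ∀ {lam} → 0ℚ < lam → 0ℚ ≤ Λ lam
0≤Λ {lam} 0<lam = ≤-trans (<⇒≤ 0<lam) (lam≤Λ lam)

lam^a≤lam^b*Λ^N : ∀ {lam} → 0ℚ < lam → ∀ {a b c d N} → a ℕ.+ c ≡ b ℕ.+ d → c ℕ.≤ N → d ℕ.≤ N →
                  lam ^ℚ a ≤ lam ^ℚ b * Λ lam ^ℚ N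
lam^a≤lam^b*Λ^N {lam} 0<lam {a} {b} {c} {d} {N} a+c≡b+d c≤N d≤N with ≤-total 1ℚ lam
... | inj₁ 1≤lam = begin
  lam ^ℚ a                     ≤⟨ a≤a+c ⟩
  lam ^ℚ (a ℕ.+ c)             ≡⟨ cong (lam ^ℚ_) a+c≡b+d ⟩
  lam ^ℚ (b ℕ.+ d)             ≡⟨ ^ℚ-distribˡ-+-* lam b d ⟩
  lam ^ℚ b * lam ^ℚ d          ≤⟨ *-monoˡ-≤ (^ℚ-nonNeg b 0≤lam) (^ℚ-monoʳ-≤ 1≤lam d≤N) ⟩
  lam ^ℚ b * lam ^ℚ N          ≤⟨ *-monoˡ-≤ (^ℚ-nonNeg b 0≤lam) (^ℚ-monoˡ-≤ N 0≤lam (lam≤Λ lam)) ⟩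
  lam ^ℚ b * Λ lam ^ℚ N        ∎
  where
    open ≤-Reasoning
    0≤lam = <⇒≤ 0<lam
    a≤a+c : lam ^ℚ a ≤ lam ^ℚ (a ℕ.+ c)
    a≤a+c = ^ℚ-monoʳ-≤ 1≤lam (ℕ.m≤m+n a c)
... | inj₂ lam≤1 = begin
  lam ^ℚ a                                ≡⟨ *-identityʳ _ ⟨
  lam ^ℚ a * 1ℚ                           ≡⟨ cong (lam ^ℚ a *_) lam^c*μ^c≡1 ⟨
  lam ^ℚ a * (lam ^ℚ c * μ ^ℚ c)          ≡⟨ *-assoc (lam ^ℚ a) (lam ^ℚ c) (μ ^ℚ c) ⟨
  lam ^ℚ a * lam ^ℚ c * μ ^ℚ c            ≡⟨ cong (_* μ ^ℚ c) (trans (sym (^ℚ-distribˡ-+-* lam a c)) (trans (cong (lam ^ℚ_) a+c≡b+d) (^ℚ-distribˡ-+-* lam b d))) ⟩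
  lam ^ℚ b * lam ^ℚ d * μ ^ℚ c            ≤⟨ *-monoʳ-≤ (^ℚ-nonNeg c 0≤μ) (*-monoˡ-≤ (^ℚ-nonNeg b 0≤lam) (^ℚ-≤1 d 0≤lam lam≤1)) ⟩
  lam ^ℚ b * 1ℚ * μ ^ℚ c                  ≡⟨ cong (_* μ ^ℚ c) (*-identityʳ (lam ^ℚ b)) ⟩
  lam ^ℚ b * μ ^ℚ c                       ≤⟨ *-monoˡ-≤ (^ℚ-nonNeg b 0≤lam) (^ℚ-monoʳ-≤ (1≤inv 0<lam lam≤1) c≤N) ⟩
  lam ^ℚ b * μ ^ℚ N                       ≤⟨ *-monoˡ-≤ (^ℚ-nonNeg b 0≤lam) (^ℚ-monoˡ-≤ N 0≤μ (inv≤Λ lam)) ⟩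
  lam ^ℚ b * Λ lam ^ℚ N                   ∎
  where
    open ≤-Reasoning
    0≤lam = <⇒≤ 0<lam
    μ = inv lam
    0≤μ = <⇒≤ (0<inv 0<lam)
    lam^c*μ^c≡1 : lam ^ℚ c * μ ^ℚ c ≡ 1ℚ
    lam^c*μ^c≡1 = trans (sym (^ℚ-distribʳ-* lam μ c)) (trans (cong (_^ℚ c) (*-inv 0<lam)) (1^ℚ c))

module _ {A : Set} where

  sumℚ-++ : ∀ (f : A → ℚ) xs ys → sumℚ (map f (xs ++ ys)) ≡ sumℚ (map f xs) + sumℚ (map f ys)
  sumℚ-++ f []       ys = sym (+-identityˡ _)
  sumℚ-++ f (x ∷ xs) ys rewrite sumℚ-++ f xs ys = sym (+-assoc (f x) _ _)

  sumℚ-↭ : ∀ (f : A → ℚ) {xs ys} → xs ↭ ys → sumℚ (map f xs) ≡ sumℚ (map f ys)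
  sumℚ-↭ f ↭.refl                   = refl
  sumℚ-↭ f (↭.prep x p)             = cong (f x +_) (sumℚ-↭ f p)
  sumℚ-↭ f (↭.swap {xs} {ys} x y p) =
    trans (solve 3 (λ a b s → a :+ (b :+ s) := b :+ (a :+ s)) refl (f x) (f y) (sumℚ (map f xs)))
            (cong (λ s → f y + (f x + s)) (sumℚ-↭ f p))
  sumℚ-↭ f (↭.trans p q)            = trans (sumℚ-↭ f p) (sumℚ-↭ f q)

  sumℚ-mono-≤ : ∀ (f g : A → ℚ) xs → (∀ {x} → x ∈ xs → f x ≤ g x) → sumℚ (map f xs) ≤ sumℚ (map g xs)
  sumℚ-mono-≤ f g []       _   = ≤-refl
  sumℚ-mono-≤ f g (x ∷ xs) f≤g = +-mono-≤ (f≤g (here refl)) (sumℚ-mono-≤ f g xs (f≤g ∘ there))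

  sumℚ-nonNeg : ∀ (f : A → ℚ) xs → (∀ {x} → x ∈ xs → 0ℚ ≤ f x) → 0ℚ ≤ sumℚ (map f xs)
  sumℚ-nonNeg f []       _   = ≤-refl
  sumℚ-nonNeg f (x ∷ xs) 0≤f = +-mono-≤ (0≤f (here refl)) (sumℚ-nonNeg f xs (0≤f ∘ there))

  sumℚ-*ˡ : ∀ a (f : A → ℚ) xs → sumℚ (map (λ x → a * f x) xs) ≡ a * sumℚ (map f xs)
  sumℚ-*ˡ a f []       = sym (*-zeroʳ a)
  sumℚ-*ˡ a f (x ∷ xs) rewrite sumℚ-*ˡ a f xs = sym (*-distribˡ-+ a (f x) _)

  sumℚ-const : ∀ c (xs : List A) → sumℚ (map (λ _ → c) xs) ≡ ℕtoℚ (length xs) * c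
  sumℚ-const c []       = sym (*-zeroˡ c)
  sumℚ-const c (x ∷ xs) rewrite sumℚ-const c xs | ℕtoℚ-+ 1 (length xs) =
    trans (cong (_+ ℕtoℚ (length xs) * c) (sym (*-identityˡ c))) (sym (*-distribʳ-+ c 1ℚ (ℕtoℚ (length xs))))

  sumℚ-if : ∀ (p : A → Bool) (f : A → ℚ) xs →
            sumℚ (map (λ x → if p x then f x else 0ℚ) xs) ≡ sumℚ (map f (filterᵇ p xs))
  sumℚ-if p f []       = refl
  sumℚ-if p f (x ∷ xs) with p x
  ... | true  = cong (f x +_) (sumℚ-if p f xs)
  ... | false = trans (+-identityˡ _) (sumℚ-if p f xs)

  ≤sumℚ : ∀ (f : A → ℚ) {x} xs → (∀ {y} → y ∈ xs → 0ℚ ≤ f y) → x ∈ xs → f x ≤ sumℚ (map f xs)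
  ≤sumℚ f {x} xs 0≤f x∈ with ∈-∃++ x∈
  ... | as , bs , refl = begin
    f x                                 ≡⟨ +-identityʳ (f x) ⟨
    f x + 0ℚ                            ≤⟨ +-monoʳ-≤ (f x) (sumℚ-nonNeg f (as ++ bs) (0≤f ∘ ∈-resp-↭ (↭-sym (shift x as bs)) ∘ there)) ⟩
    f x + sumℚ (map f (as ++ bs))       ≡⟨ sumℚ-↭ f (shift x as bs) ⟨
    sumℚ (map f (as ++ x ∷ bs))         ∎
    where open ≤-Reasoning

  0<sumℚ⇒ : ∀ (f : A → ℚ) xs → 0ℚ < sumℚ (map f xs) → ∃ λ x → x ∈ xs × 0ℚ < f x
  0<sumℚ⇒ f []       0<0 = ⊥-elim (<-irrefl refl 0<0)
  0<sumℚ⇒ f (y ∷ xs) 0<s with 0ℚ ℚ.<? f y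
  ... | yes 0<fy = y , here refl , 0<fy
  ... | no  0≮fy =
    let x , x∈ , 0<fx = 0<sumℚ⇒ f xs (<-≤-trans 0<s (≤-trans (+-monoˡ-≤ _ (≮⇒≥ 0≮fy)) (≤-reflexive (+-identityˡ _))))
    in  x , there x∈ , 0<fx

  sumℚ≡0 : ∀ (f : A → ℚ) xs → (∀ {x} → x ∈ xs → f x ≡ 0ℚ) → sumℚ (map f xs) ≡ 0ℚ
  sumℚ≡0 f []       _   = refl
  sumℚ≡0 f (x ∷ xs) f≡0 rewrite f≡0 (here refl) | sumℚ≡0 f xs (f≡0 ∘ there) = refl

  sumℚ-⊆-≤ : ∀ (g : A → ℚ) zs ys → Unique zs → (∀ {z} → z ∈ zs → z ∈ ys) → (∀ {y} → y ∈ ys → 0ℚ ≤ g y) →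
             sumℚ (map g zs) ≤ sumℚ (map g ys)
  sumℚ-⊆-≤ g []       ys _             _   0≤g = sumℚ-nonNeg g ys 0≤g
  sumℚ-⊆-≤ g (z ∷ zs) ys (z∉zs ∷ uniq) zs⊆ 0≤g with ∈-∃++ (zs⊆ (here refl))
  ... | as , bs , refl = begin
    g z + sumℚ (map g zs)            ≤⟨ +-monoʳ-≤ (g z) (sumℚ-⊆-≤ g zs (as ++ bs) uniq zs⊆as++bs (0≤g ∘ ∈-resp-↭ (↭-sym (shift z as bs)) ∘ there)) ⟩
    g z + sumℚ (map g (as ++ bs))    ≡⟨ sumℚ-↭ g (shift z as bs) ⟨
    sumℚ (map g (as ++ z ∷ bs))      ∎
    where
      open ≤-Reasoning
      zs⊆as++bs : ∀ {x} → x ∈ zs → x ∈ as ++ bs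
      zs⊆as++bs x∈ with ∈-resp-↭ (shift z as bs) (zs⊆ (there x∈))
      ... | here x≡z = ⊥-elim (All.lookup z∉zs x∈ (sym x≡z))
      ... | there x∈′ = x∈′

module _ {A B : Set} where

  sumℚ-injection-≤ : ∀ (φ : A → B) (f : A → ℚ) (g : B → ℚ) xs ys → Unique xs →
                     (∀ {x x′} → x ∈ xs → x′ ∈ xs → φ x ≡ φ x′ → x ≡ x′) → (∀ {x} → x ∈ xs → φ x ∈ ys) →
                     (∀ {x} → x ∈ xs → f x ≤ g (φ x)) → (∀ {y} → y ∈ ys → 0ℚ ≤ g y) →
                     sumℚ (map f xs) ≤ sumℚ (map g ys)
  sumℚ-injection-≤ φ f g xs ys uniq φ-inj φ-into f≤gφ 0≤g = begin
    sumℚ (map f xs)         ≤⟨ sumℚ-mono-≤ f (g ∘ φ) xs f≤gφ ⟩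
    sumℚ (map (g ∘ φ) xs)   ≡⟨ cong sumℚ (List.map-∘ xs) ⟩
    sumℚ (map g (map φ xs)) ≤⟨ sumℚ-⊆-≤ g (map φ xs) ys (map-unique xs uniq φ-inj) image⊆ys 0≤g ⟩
    sumℚ (map g ys)         ∎
    where
      open ≤-Reasoning
      image⊆ys : ∀ {y} → y ∈ map φ xs → y ∈ ys
      image⊆ys y∈ with ∈-map⁻ φ y∈
      ... | x , x∈ , refl = φ-into x∈
      map-unique : ∀ xs → Unique xs → (∀ {x x′} → x ∈ xs → x′ ∈ xs → φ x ≡ φ x′ → x ≡ x′) → Unique (map φ xs)
      map-unique []       _           _     = []
      map-unique (x ∷ xs) (x∉ ∷ uniq) φ-inj =
        AllP.map⁺ (All.tabulate λ x′∈ φx≡φx′ → All.lookup x∉ x′∈ (φ-inj (here refl) (there x′∈) φx≡φx′))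
        ∷ map-unique xs uniq (λ x∈ x′∈ → φ-inj (there x∈) (there x′∈))


  sumℚ-cartesianProduct : ∀ (F : A → B → ℚ) xs ys →
    sumℚ (map (λ x → sumℚ (map (F x) ys)) xs) ≡ sumℚ (map (uncurry F) (cartesianProduct xs ys))
  sumℚ-cartesianProduct F []       ys = refl
  sumℚ-cartesianProduct F (x ∷ xs) ys = begin
    sumℚ (map (F x) ys) + sumℚ (map (λ x → sumℚ (map (F x) ys)) xs)
      ≡⟨ cong₂ _+_ (cong sumℚ (List.map-∘ ys)) (sumℚ-cartesianProduct F xs ys) ⟩
    sumℚ (map (uncurry F) (map (x ,_) ys)) + sumℚ (map (uncurry F) (cartesianProduct xs ys))
      ≡⟨ sumℚ-++ (uncurry F) (map (x ,_) ys) (cartesianProduct xs ys) ⟨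
    sumℚ (map (uncurry F) (map (x ,_) ys ++ cartesianProduct xs ys)) ∎
    where open ≡-Reasoning

  sumℚ-cartesianProduct-proj₁ : ∀ (f : A → ℚ) xs (ys : List B) →
    sumℚ (map (f ∘ proj₁) (cartesianProduct xs ys)) ≡ ℕtoℚ (length ys) * sumℚ (map f xs)
  sumℚ-cartesianProduct-proj₁ f xs ys = begin
    sumℚ (map (f ∘ proj₁) (cartesianProduct xs ys))         ≡⟨ sumℚ-cartesianProduct (λ x _ → f x) xs ys ⟨
    sumℚ (map (λ x → sumℚ (map (λ _ → f x) ys)) xs)         ≡⟨ cong sumℚ (List.map-cong (λ x → sumℚ-const (f x) ys) xs) ⟩
    sumℚ (map (λ x → ℕtoℚ (length ys) * f x) xs)            ≡⟨ sumℚ-*ˡ (ℕtoℚ (length ys)) f xs ⟩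
    ℕtoℚ (length ys) * sumℚ (map f xs)                      ∎
    where open ≡-Reasoning

  length-cartesianProduct : ∀ (xs : List A) (ys : List B) → length (cartesianProduct xs ys) ≡ length xs ℕ.* length ys
  length-cartesianProduct []       ys = refl
  length-cartesianProduct (x ∷ xs) ys =
    trans (List.length-++ (map (x ,_) ys)) (cong₂ ℕ._+_ (List.length-map (x ,_) ys) (length-cartesianProduct xs ys))

-- Hard-core model and Glauber dynamics

module HardCore {n : ℕ} (G : Graph n) {lam : ℚ} (0<lam : 0ℚ < lam) where

  ∅-indep : Indep G ∅
  ∅-indep = nonadjacent⇒Indep G ∅ λ u _ ∅u _ → ⊥-elim (true≢false (trans (sym ∅u) (Vec.lookup-replicate u false)))

  0<Z : 0ℚ < Z G lam
  0<Z = <-≤-trans (^ℚ-pos ∣ ∅ {n} ∣ˢ 0<lam)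
                  (≤sumℚ (λ J → lam ^ℚ ∣ J ∣ˢ) (indeps G) (λ {J} _ → ^ℚ-nonNeg ∣ J ∣ˢ (<⇒≤ 0<lam)) (∈-indeps⁺ G {∅} ∅-indep))

  π-nonNeg : ∀ I → 0ℚ ≤ π G lam I
  π-nonNeg I = *-nonNeg (^ℚ-nonNeg ∣ I ∣ˢ (<⇒≤ 0<lam)) (<⇒≤ (0<inv 0<Z))

  π-pos : ∀ I → 0ℚ < π G lam I
  π-pos I = *-pos (^ℚ-pos ∣ I ∣ˢ 0<lam) (0<inv 0<Z)

  sumℚ-π≡1 : sumℚ (map (π G lam) (indeps G)) ≡ 1ℚ
  sumℚ-π≡1 = begin
    sumℚ (map (π G lam) (indeps G))                          ≡⟨ cong sumℚ (List.map-cong (λ I → *-comm (lam ^ℚ ∣ I ∣ˢ) _) (indeps G)) ⟩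
    sumℚ (map (λ I → inv (Z G lam) * lam ^ℚ ∣ I ∣ˢ) (indeps G)) ≡⟨ sumℚ-*ˡ (inv (Z G lam)) (λ I → lam ^ℚ ∣ I ∣ˢ) (indeps G) ⟩
    inv (Z G lam) * Z G lam                                  ≡⟨ inv-* 0<Z ⟩
    1ℚ                                                       ∎
    where open ≡-Reasoning

  0<lam+1 : 0ℚ < lam + 1ℚ
  0<lam+1 = <-≤-trans 0<lam (≤-trans (≤-reflexive (sym (+-identityʳ lam))) (+-monoʳ-≤ lam (<⇒≤ 0<1)))

  0<n : Fin n → 0ℚ < ℕtoℚ n
  0<n v = ℕtoℚ-pos n (ℕ.≤-<-trans ℕ.z≤n (Fin.toℕ<n v))

  moveProb-nonNeg : ∀ W v → 0ℚ ≤ moveProb G lam W v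
  moveProb-nonNeg W v with lookup W v | isIndep G (W [ v ]≔ true)
  ... | true  | _     = *-nonNeg (<⇒≤ (0<inv (0<n v))) (<⇒≤ (0<inv 0<lam+1))
  ... | false | true  = *-nonNeg (<⇒≤ (0<inv (0<n v))) (*-nonNeg (<⇒≤ 0<lam) (<⇒≤ (0<inv 0<lam+1)))
  ... | false | false = ≤-refl

  positive-transition : ∀ {W W′} → (W ==ˢ W′) ≡ false → 0ℚ < P G lam W W′ →
                        ∃ λ v → flip G lam W v ≡ W′ × 0ℚ < moveProb G lam W v × moveProb G lam W v ≤ P G lam W W′
  positive-transition {W} {W′} W≠W′ 0<P =
    let v , v∈ , 0<term = 0<sumℚ⇒ term (allFin n) (subst (0ℚ <_) P≡ 0<P)
        flipped , term≡ = selected v 0<term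
    in  v , flipped , subst (0ℚ <_) term≡ 0<term
          , subst₂ _≤_ term≡ (sym P≡) (≤sumℚ term (allFin n) (λ {u} _ → term-nonNeg u) v∈)
    where
      term : Fin n → ℚ
      term v = if flip G lam W v ==ˢ W′ then moveProb G lam W v else 0ℚ
      P≡ : P G lam W W′ ≡ sumℚ (map term (allFin n))
      P≡ rewrite W≠W′ = refl
      term-nonNeg : ∀ v → 0ℚ ≤ term v
      term-nonNeg v with flip G lam W v ==ˢ W′
      ... | true  = moveProb-nonNeg W v
      ... | false = ≤-refl
      selected : ∀ v → 0ℚ < term v → flip G lam W v ≡ W′ × term v ≡ moveProb G lam W v
      selected v 0<term with flip G lam W v ==ˢ W′ in flipped
      ... | true  = ==ˢ⇒≡ _ _ flipped , refl
      ... | false = ⊥-elim (<-irrefl refl 0<term)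

  1≤2Λ/[lam+1] : 1ℚ ≤ (1ℚ + 1ℚ) * Λ lam * inv (lam + 1ℚ)
  1≤2Λ/[lam+1] = begin
    1ℚ                                  ≡⟨ *-inv 0<lam+1 ⟨
    (lam + 1ℚ) * inv (lam + 1ℚ)         ≤⟨ *-monoʳ-≤ (<⇒≤ (0<inv 0<lam+1)) (+-mono-≤ (lam≤Λ lam) (1≤Λ 0<lam)) ⟩
    (Λ lam + Λ lam) * inv (lam + 1ℚ)    ≡⟨ solve 2 (λ Λ′ i → (Λ′ :+ Λ′) :* i := (con 1ℚ :+ con 1ℚ) :* Λ′ :* i) refl (Λ lam) (inv (lam + 1ℚ)) ⟩
    (1ℚ + 1ℚ) * Λ lam * inv (lam + 1ℚ)  ∎
    where open ≤-Reasoning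

  1≤2Λlam/[lam+1] : 1ℚ ≤ (1ℚ + 1ℚ) * Λ lam * (lam * inv (lam + 1ℚ))
  1≤2Λlam/[lam+1] = begin
    1ℚ                                          ≡⟨ *-inv 0<lam+1 ⟨
    (lam + 1ℚ) * inv (lam + 1ℚ)                 ≤⟨ *-monoʳ-≤ (<⇒≤ (0<inv 0<lam+1)) (+-mono-≤ lam≤Λlam 1≤Λlam) ⟩
    (Λ lam * lam + Λ lam * lam) * inv (lam + 1ℚ) ≡⟨ solve 3 (λ Λ′ l i → (Λ′ :* l :+ Λ′ :* l) :* i := (con 1ℚ :+ con 1ℚ) :* Λ′ :* (l :* i)) refl (Λ lam) lam (inv (lam + 1ℚ)) ⟩
    (1ℚ + 1ℚ) * Λ lam * (lam * inv (lam + 1ℚ))  ∎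
    where
      open ≤-Reasoning
      lam≤Λlam : lam ≤ Λ lam * lam
      lam≤Λlam = ≤-trans (≤-reflexive (sym (*-identityˡ lam))) (*-monoʳ-≤ (<⇒≤ 0<lam) (1≤Λ 0<lam))
      1≤Λlam : 1ℚ ≤ Λ lam * lam
      1≤Λlam = ≤-trans (≤-reflexive (sym (inv-* 0<lam))) (*-monoʳ-≤ (<⇒≤ 0<lam) (inv≤Λ lam))

  1≤2nΛ·r/n : Fin n → ∀ {r} → 1ℚ ≤ (1ℚ + 1ℚ) * Λ lam * r → 1ℚ ≤ ℕtoℚ (n ℕ.+ n) * Λ lam * (inv (ℕtoℚ n) * r)
  1≤2nΛ·r/n v {r} 1≤2Λr = ≤-trans 1≤2Λr (≤-reflexive (begin
    (1ℚ + 1ℚ) * Λ lam * r                                  ≡⟨ *-identityˡ _ ⟨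
    1ℚ * ((1ℚ + 1ℚ) * Λ lam * r)                           ≡⟨ cong (_* ((1ℚ + 1ℚ) * Λ lam * r)) (*-inv (0<n v)) ⟨
    ℕtoℚ n * inv (ℕtoℚ n) * ((1ℚ + 1ℚ) * Λ lam * r)        ≡⟨ solve 4 (λ m i Λ′ r′ → m :* i :* ((con 1ℚ :+ con 1ℚ) :* Λ′ :* r′) := (m :+ m) :* Λ′ :* (i :* r′)) refl (ℕtoℚ n) (inv (ℕtoℚ n)) (Λ lam) r ⟩
    (ℕtoℚ n + ℕtoℚ n) * Λ lam * (inv (ℕtoℚ n) * r)         ≡⟨ cong (λ m → m * Λ lam * (inv (ℕtoℚ n) * r)) (ℕtoℚ-+ n n) ⟨
    ℕtoℚ (n ℕ.+ n) * Λ lam * (inv (ℕtoℚ n) * r)            ∎))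
    where open ≡-Reasoning

  -- Every Glauber move has probability (1/n) r with r = 1/(λ+1) or λ/(λ+1), and 2 λ̃ r ≥ 1.
  moveProb-lower : ∀ W v → 0ℚ < moveProb G lam W v → 1ℚ ≤ ℕtoℚ (n ℕ.+ n) * Λ lam * moveProb G lam W v
  moveProb-lower W v 0<mp with lookup W v | isIndep G (W [ v ]≔ true)
  ... | true  | _     = 1≤2nΛ·r/n v 1≤2Λ/[lam+1]
  ... | false | true  = 1≤2nΛ·r/n v 1≤2Λlam/[lam+1]
  ... | false | false = ⊥-elim (<-irrefl refl 0<mp)

-- Congestion

≤-foldr-⊔ : ∀ {A : Set} (f : A → ℕ) {x} xs → x ∈ xs → f x ℕ.≤ foldr (λ y m → f y ℕ.⊔ m) 0 xs
≤-foldr-⊔ f (y ∷ xs) (here refl) = ℕ.m≤m⊔n (f y) _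
≤-foldr-⊔ f (y ∷ xs) (there x∈) = ℕ.≤-trans (≤-foldr-⊔ f xs x∈) (ℕ.m≤n⊔m (f y) _)

unique-moves-length : ∀ {n} {ms : List (Move n)} → Unique ms → ℕtoℚ (length ms) ≤ ℕtoℚ (n ℕ.+ n)
unique-moves-length {n} {ms} uniq = begin
  ℕtoℚ (length ms)                   ≡⟨ *-identityʳ _ ⟨
  ℕtoℚ (length ms) * 1ℚ              ≡⟨ sumℚ-const 1ℚ ms ⟨
  sumℚ (map (λ _ → 1ℚ) ms)           ≤⟨ sumℚ-⊆-≤ (λ _ → 1ℚ) ms allMoves uniq ∈allMoves (λ _ → <⇒≤ 0<1) ⟩
  sumℚ (map (λ _ → 1ℚ) allMoves)     ≡⟨ sumℚ-const 1ℚ allMoves ⟩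
  ℕtoℚ (length allMoves) * 1ℚ        ≡⟨ *-identityʳ _ ⟩
  ℕtoℚ (length allMoves)             ≡⟨ cong ℕtoℚ length-allMoves ⟩
  ℕtoℚ (n ℕ.+ n)                     ∎
  where
    open ≤-Reasoning
    allMoves : List (Move n)
    allMoves = map rem (allFin n) ++ map add (allFin n)
    ∈allMoves : ∀ {m} → m ∈ ms → m ∈ allMoves
    ∈allMoves {rem v} _ = ∈-++⁺ˡ (∈-map⁺ rem (∈-allFin v))
    ∈allMoves {add v} _ = ∈-++⁺ʳ (map rem (allFin n)) (∈-map⁺ add (∈-allFin v))
    length-allMoves : length allMoves ≡ n ℕ.+ n
    length-allMoves = trans (List.length-++ (map rem (allFin n)))
      (cong₂ ℕ._+_ (trans (List.length-map rem (allFin n)) (List.length-tabulate {n = n} (λ v → v))) (trans (List.length-map add (allFin n)) (List.length-tabulate {n = n} (λ v → v))))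

module Flow {n q : ℕ} (G : Graph n) (X : Fin (suc q) → Subset n) (pd : IsPathDecomp G X) (X-last : X (fromℕ q) ≡ ∅)
            {lam : ℚ} (0<lam : 0ℚ < lam) (γ : Subset n → Subset n → List (Move n))
            (canonical : ∀ I J → Indep G I → Indep G J → IsCanonical X I J (γ I J)) (W W′ : Subset n) where
  open PathDecomposition G X pd X-last
  open HardCore G 0<lam
  open Schedule τ τ-rem<add using (Step; step)

  uses : Subset n → Subset n → Bool
  uses K L = any (λ e → (proj₁ e ==ˢ W) ∧ (proj₂ e ==ˢ W′)) (transitions K (γ K L))

  weight : Subset n → Subset n → ℚ
  weight K L = π G lam K * π G lam L * ℕtoℚ (length (γ K L))

  flow : ℚ
  flow = sumℚ (map (λ K → sumℚ (map (λ L → if uses K L then weight K L else 0ℚ) (indeps G))) (indeps G))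

  uses⇒step : ∀ {K L} → Indep G K → Indep G L → uses K L ≡ true → Step K L W W′
  uses⇒step {K} {L} K-indep L-indep used =
    let (W₀ , W₁) , e∈ , e≡ = any≡true⁻ _ (transitions K (γ K L)) used
        W₀≡W , W₁≡W′ = ∧≡true⁻ e≡
    in  step (canonical⇒schedule {K} {L} (canonical K L K-indep L-indep))
             (subst (_∈ transitions K (γ K L)) (cong₂ _,_ (==ˢ⇒≡ W₀ W W₀≡W) (==ˢ⇒≡ W₁ W′ W₁≡W′)) e∈)

  flow-loop : (W ==ˢ W′) ≡ true → flow ≡ 0ℚ
  flow-loop W≡W′ = sumℚ≡0 _ (indeps G) λ K∈ → sumℚ≡0 _ (indeps G) λ L∈ → unused K∈ L∈
    where
      unused : ∀ {K L} → K ∈ indeps G → L ∈ indeps G → (if uses K L then weight K L else 0ℚ) ≡ 0ℚ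
      unused {K} {L} K∈ L∈ with uses K L in used
      ... | false = refl
      ... | true  = ⊥-elim (not-¬ refl (trans (sym (trans (cong (λ Y → lookup Y (vertex move)) (trans (==ˢ⇒≡ W W′ W≡W′) W′≡))
                                                               (lookup∘applyMove move W))) flips))
        where open Step (uses⇒step (∈-indeps⁻ G K∈) (∈-indeps⁻ G L∈) used)

  length-γ : ∀ {K L} → Indep G K → Indep G L → ℕtoℚ (length (γ K L)) ≤ ℕtoℚ (n ℕ.+ n)
  length-γ {K} {L} K-indep L-indep =
    unique-moves-length (Schedule.IsSchedule.unique (canonical⇒schedule {K} {L} (canonical K L K-indep L-indep)))

  α M : ℕ
  α = foldr (λ s m → alphaIn G (X s) ℕ.⊔ m) 0 (allFin (suc q))
  M = foldr (λ s m → length (indepsIn G (X s)) ℕ.⊔ m) 0 (allFin (suc q))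

  ∣∣≤α : ∀ s {S} → S ∈ indepsIn G (X s) → ∣ S ∣ˢ ℕ.≤ α
  ∣∣≤α s S∈ = ℕ.≤-trans (≤-foldr-⊔ ∣_∣ˢ (indepsIn G (X s)) S∈) (≤-foldr-⊔ (λ s → alphaIn G (X s)) (allFin (suc q)) (∈-allFin s))

  length≤M : ∀ s → length (indepsIn G (X s)) ℕ.≤ M
  length≤M s = ≤-foldr-⊔ (λ s → length (indepsIn G (X s))) (allFin (suc q)) (∈-allFin s)

  ∩∈indepsIn : ∀ s {S} → Indep G S → X s ∩ S ∈ indepsIn G (X s)
  ∩∈indepsIn s {S} S-indep = ∈-indepsIn⁺ G {X s} {X s ∩ S} (Indep-⊆ G {S} {X s ∩ S} S-indep (∩-⊆ʳ (X s) S)) (∩-⊆ˡ (X s) S)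

  N : ℕ
  N = 2 ℕ.* α

  +≤N : ∀ {a b} → a ℕ.≤ α → b ℕ.≤ α → a ℕ.+ b ℕ.≤ N
  +≤N {a} {b} a≤α b≤α = subst (a ℕ.+ b ℕ.≤_) (cong (α ℕ.+_) (sym (ℕ.+-identityʳ α))) (ℕ.+-mono-≤ a≤α b≤α)

  C : ℚ
  C = ℕtoℚ (n ℕ.+ n) * π G lam W * Λ lam ^ℚ N

  0≤C : 0ℚ ≤ C
  0≤C = *-nonNeg (*-nonNeg (ℕtoℚ-nonNeg (n ℕ.+ n)) (π-nonNeg W)) (^ℚ-nonNeg N (0≤Λ 0<lam))

  bound-nonNeg : 0ℚ ≤ bound G X lam
  bound-nonNeg = *-nonNeg (*-nonNeg (*-nonNeg (ℕtoℚ-nonNeg 4) (ℕtoℚ-nonNeg (n ℕ.* n))) (^ℚ-nonNeg (N ℕ.+ 1) (0≤Λ 0<lam))) (ℕtoℚ-nonNeg (M ℕ.* M))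

  -- One factor 2nλ̃ is paid by the transition probability, which is at least 1/(2nλ̃).
  C*M²≤ : 1ℚ ≤ ℕtoℚ (n ℕ.+ n) * Λ lam * P G lam W W′ → C * ℕtoℚ (M ℕ.* M) ≤ π G lam W * P G lam W W′ * bound G X lam
  C*M²≤ 1≤2nΛP = begin
    C * ℕtoℚ (M ℕ.* M)                                          ≡⟨ *-identityʳ _ ⟨
    C * ℕtoℚ (M ℕ.* M) * 1ℚ                                     ≤⟨ *-monoˡ-≤ (*-nonNeg 0≤C (ℕtoℚ-nonNeg (M ℕ.* M))) 1≤2nΛP ⟩
    C * ℕtoℚ (M ℕ.* M) * (ℕtoℚ (n ℕ.+ n) * Λ lam * P G lam W W′) ≡⟨ rearranged ⟩
    π G lam W * P G lam W W′ * bound G X lam                    ∎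
    where
      open ≤-Reasoning
      a = ℕtoℚ (n ℕ.+ n)
      a*a≡4n² : a * a ≡ ℕtoℚ 4 * ℕtoℚ (n ℕ.* n)
      a*a≡4n² = trans (sym (ℕtoℚ-* (n ℕ.+ n) (n ℕ.+ n))) (trans (cong ℕtoℚ (4n² n)) (ℕtoℚ-* 4 (n ℕ.* n)))
        where
          4n² : ∀ n → (n ℕ.+ n) ℕ.* (n ℕ.+ n) ≡ 4 ℕ.* (n ℕ.* n)
          4n² = solve-∀
      rearranged : C * ℕtoℚ (M ℕ.* M) * (a * Λ lam * P G lam W W′) ≡ π G lam W * P G lam W W′ * bound G X lam
      rearranged = begin-equality
        C * ℕtoℚ (M ℕ.* M) * (a * Λ lam * P G lam W W′)
          ≡⟨ solve 6 (λ a w l lᴺ μ p → a :* w :* lᴺ :* μ :* (a :* l :* p) := w :* p :* (a :* a :* (lᴺ :* l) :* μ))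
                   refl a (π G lam W) (Λ lam) (Λ lam ^ℚ N) (ℕtoℚ (M ℕ.* M)) (P G lam W W′) ⟩
        π G lam W * P G lam W W′ * (a * a * (Λ lam ^ℚ N * Λ lam) * ℕtoℚ (M ℕ.* M))
          ≡⟨ cong₂ (λ x y → π G lam W * P G lam W W′ * (x * y * ℕtoℚ (M ℕ.* M))) a*a≡4n² Λᴺ*Λ≡Λᴺ⁺¹ ⟩
        π G lam W * P G lam W W′ * bound G X lam ∎
        where
          Λᴺ*Λ≡Λᴺ⁺¹ : Λ lam ^ℚ N * Λ lam ≡ Λ lam ^ℚ (N ℕ.+ 1)
          Λᴺ*Λ≡Λᴺ⁺¹ = trans (cong (Λ lam ^ℚ N *_) (sym (*-identityʳ (Λ lam)))) (sym (^ℚ-distribˡ-+-* (Λ lam) N 1))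

  module Flipping (v : Fin n) (flipped : flip G lam W v ≡ W′) (W-indep : Indep G W) where

    -- Every canonical path through (W, W′) makes its move in this bag.
    t : Fin (suc q)
    t = bagOf (flipMove W v)

    open AtBag G X pd X-last t W

    uses⇒Compatible : ∀ {K L} → Indep G K → Indep G L → uses K L ≡ true → Compatible K L
    uses⇒Compatible K-indep L-indep used =
      step⇒Compatible st (trans (cong block move≡flipMove) (sym (toℕ-bagOf (flipMove W v))))
      where
        st = uses⇒step K-indep L-indep used
        open Step st
        move≡flipMove : move ≡ flipMove W v
        move≡flipMove = flipping-move-unique (trans (sym W′≡) (trans (sym flipped) (flip≡applyMove G lam W v)))
                                             flips (flipMove-flips W v)

    π*π≤ : ∀ {K L} → Indep G K → Indep G L → Compatible K L → π G lam K * π G lam L ≤ π G lam (η K L) * π G lam W * Λ lam ^ℚ N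
    π*π≤ {K} {L} K-indep L-indep compatible = begin
      lam ^ℚ ∣ K ∣ˢ * c * (lam ^ℚ ∣ L ∣ˢ * c)                  ≡⟨ pair (lam ^ℚ ∣ K ∣ˢ) (lam ^ℚ ∣ L ∣ˢ) ⟩
      lam ^ℚ ∣ K ∣ˢ * lam ^ℚ ∣ L ∣ˢ * (c * c)                  ≡⟨ cong (_* (c * c)) (^ℚ-distribˡ-+-* lam ∣ K ∣ˢ ∣ L ∣ˢ) ⟨
      lam ^ℚ (∣ K ∣ˢ ℕ.+ ∣ L ∣ˢ) * (c * c)                     ≤⟨ *-monoʳ-≤ (*-nonNeg 0≤c 0≤c) exchange ⟩
      lam ^ℚ (∣ η K L ∣ˢ ℕ.+ ∣ W ∣ˢ) * Λ lam ^ℚ N * (c * c)   ≡⟨ cong (λ x → x * Λ lam ^ℚ N * (c * c)) (^ℚ-distribˡ-+-* lam ∣ η K L ∣ˢ ∣ W ∣ˢ) ⟩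
      lam ^ℚ ∣ η K L ∣ˢ * lam ^ℚ ∣ W ∣ˢ * Λ lam ^ℚ N * (c * c) ≡⟨ regroup (lam ^ℚ ∣ η K L ∣ˢ) (lam ^ℚ ∣ W ∣ˢ) (Λ lam ^ℚ N) ⟩
      lam ^ℚ ∣ η K L ∣ˢ * c * (lam ^ℚ ∣ W ∣ˢ * c) * Λ lam ^ℚ N ∎
      where
        open ≤-Reasoning
        c = inv (Z G lam)
        0≤c = <⇒≤ (0<inv 0<Z)
        pair : ∀ a b → a * c * (b * c) ≡ a * b * (c * c)
        pair a b = solve 3 (λ a b c → a :* c :* (b :* c) := a :* b :* (c :* c)) refl a b c
        regroup : ∀ a b d → a * b * d * (c * c) ≡ a * c * (b * c) * d
        regroup a b d = solve 4 (λ a b d c → a :* b :* d :* (c :* c) := a :* c :* (b :* c) :* d) refl a b d c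
        exchange : lam ^ℚ (∣ K ∣ˢ ℕ.+ ∣ L ∣ˢ) ≤ lam ^ℚ (∣ η K L ∣ˢ ℕ.+ ∣ W ∣ˢ) * Λ lam ^ℚ N
        exchange = lam^a≤lam^b*Λ^N 0<lam {b = ∣ η K L ∣ˢ ℕ.+ ∣ W ∣ˢ} (size-identity {K} {L} compatible)
          (ℕ.≤-trans ∣Wᵗ∣≤ (+≤N (∣∣≤α t (∩∈indepsIn t {W} W-indep)) (∣∣≤α t⁻ (∩∈indepsIn t⁻ {W} W-indep))))
          (+≤N (∣∣≤α t (∩∈indepsIn t {K} K-indep)) (∣∣≤α t⁻ (∩∈indepsIn t⁻ {L} L-indep)))

    used-pairs : List (Subset n × Subset n)
    used-pairs = filterᵇ (λ p → uses (proj₁ p) (proj₂ p)) (cartesianProduct (indeps G) (indeps G))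

    images : List (Subset n × (Subset n × Subset n))
    images = cartesianProduct (indeps G) (cartesianProduct (indepsIn G (X t)) (indepsIn G (X t⁻)))

    ∈-used-pairs⁻ : ∀ {K L} → (K , L) ∈ used-pairs → Indep G K × Indep G L × uses K L ≡ true
    ∈-used-pairs⁻ p∈ =
      let p∈I×I , used = ∈-filterᵇ⁻ _ (cartesianProduct (indeps G) (indeps G)) p∈
          K∈ , L∈ = ∈-cartesianProduct⁻ (indeps G) (indeps G) p∈I×I
      in  ∈-indeps⁻ G K∈ , ∈-indeps⁻ G L∈ , used

    weight≤ : ∀ {p} → p ∈ used-pairs → weight (proj₁ p) (proj₂ p) ≤ C * π G lam (proj₁ (φ p))
    weight≤ {K , L} p∈ = begin
      π G lam K * π G lam L * ℕtoℚ (length (γ K L))   ≤⟨ *-monoˡ-≤ (*-nonNeg (π-nonNeg K) (π-nonNeg L)) (length-γ {K} {L} K-indep L-indep) ⟩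
      π G lam K * π G lam L * ℕtoℚ (n ℕ.+ n)          ≤⟨ *-monoʳ-≤ (ℕtoℚ-nonNeg (n ℕ.+ n)) (π*π≤ {K} {L} K-indep L-indep (uses⇒Compatible {K} {L} K-indep L-indep used)) ⟩
      π G lam (η K L) * π G lam W * Λ lam ^ℚ N * ℕtoℚ (n ℕ.+ n) ≡⟨ solve 4 (λ a b c d → a :* b :* c :* d := d :* b :* c :* a) refl (π G lam (η K L)) (π G lam W) (Λ lam ^ℚ N) (ℕtoℚ (n ℕ.+ n)) ⟩
      C * π G lam (η K L)                              ∎
      where
        open ≤-Reasoning
        K-indep = proj₁ (∈-used-pairs⁻ p∈)
        L-indep = proj₁ (proj₂ (∈-used-pairs⁻ p∈))
        used = proj₂ (proj₂ (∈-used-pairs⁻ p∈))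

    flow≤ : flow ≤ C * ℕtoℚ (M ℕ.* M)
    flow≤ = begin
      flow                                                                   ≡⟨ sumℚ-cartesianProduct (λ K L → if uses K L then weight K L else 0ℚ) (indeps G) (indeps G) ⟩
      sumℚ (map (λ p → if uses (proj₁ p) (proj₂ p) then weight (proj₁ p) (proj₂ p) else 0ℚ) (cartesianProduct (indeps G) (indeps G)))
                                                                             ≡⟨ sumℚ-if _ (λ p → weight (proj₁ p) (proj₂ p)) (cartesianProduct (indeps G) (indeps G)) ⟩
      sumℚ (map (λ p → weight (proj₁ p) (proj₂ p)) used-pairs)               ≤⟨ sumℚ-injection-≤ φ _ (λ y → C * π G lam (proj₁ y)) used-pairs images
                                                                                  used-pairs-unique φ-injective-on φ-into weight≤ (λ {y} _ → *-nonNeg 0≤C (π-nonNeg (proj₁ y))) ⟩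
      sumℚ (map (λ y → C * π G lam (proj₁ y)) images)                        ≡⟨ sumℚ-*ˡ C (π G lam ∘ proj₁) images ⟩
      C * sumℚ (map (π G lam ∘ proj₁) images)                                ≡⟨ cong (C *_) (sumℚ-cartesianProduct-proj₁ (π G lam) (indeps G) _) ⟩
      C * (ℕtoℚ (length (cartesianProduct (indepsIn G (X t)) (indepsIn G (X t⁻)))) * sumℚ (map (π G lam) (indeps G)))
                                                                             ≡⟨ cong₂ (λ k s → C * (ℕtoℚ k * s)) (length-cartesianProduct (indepsIn G (X t)) _) sumℚ-π≡1 ⟩
      C * (ℕtoℚ (length (indepsIn G (X t)) ℕ.* length (indepsIn G (X t⁻))) * 1ℚ) ≤⟨ *-monoˡ-≤ 0≤C (*-monoʳ-≤ (<⇒≤ 0<1) (ℕtoℚ-mono-≤ (ℕ.*-mono-≤ (length≤M t) (length≤M t⁻)))) ⟩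
      C * (ℕtoℚ (M ℕ.* M) * 1ℚ)                                              ≡⟨ cong (C *_) (*-identityʳ _) ⟩
      C * ℕtoℚ (M ℕ.* M)                                                     ∎
      where
        open ≤-Reasoning
        used-pairs-unique : Unique used-pairs
        used-pairs-unique = Unique.filter⁺ _ (Unique.cartesianProduct⁺ (indeps-unique G) (indeps-unique G))
        φ-injective-on : ∀ {p p′} → p ∈ used-pairs → p′ ∈ used-pairs → φ p ≡ φ p′ → p ≡ p′
        φ-injective-on {K , L} {K′ , L′} p∈ p′∈ =
          let K-indep , L-indep , used = ∈-used-pairs⁻ p∈
              K′-indep , L′-indep , used′ = ∈-used-pairs⁻ p′∈
          in  φ-injective (uses⇒Compatible K-indep L-indep used) (uses⇒Compatible K′-indep L′-indep used′)
        φ-into : ∀ {p} → p ∈ used-pairs → φ p ∈ images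
        φ-into {K , L} p∈ =
          let K-indep , L-indep , _ = ∈-used-pairs⁻ p∈
          in  ∈-cartesianProduct⁺ (∈-indeps⁺ G (η-indep {K} {L} K-indep L-indep))
                                  (∈-cartesianProduct⁺ (∩∈indepsIn t {K} K-indep) (∩∈indepsIn t⁻ {L} L-indep))

lemma7 : {n q : ℕ} (G : Graph n) (X : Fin (ℕ.suc q) → Subset n) →
    IsPathDecomp G X → X (fromℕ q) ≡ ∅ →
    (lam : ℚ) → 0ℚ < lam →
    (γ : Subset n → Subset n → List (Move n)) →
    (∀ I J → Indep G I → Indep G J → IsCanonical X I J (γ I J)) →
    ∀ W W' → Indep G W → Indep G W' → 0ℚ < P G lam W W' →
    congestion G lam γ W W' ≤ bound G X lam
lemma7 {n} G X pd X-last lam 0<lam γ canonical W W′ W-indep _ 0<P =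
  ≤*⇒inv*≤ (*-pos (π-pos W) 0<P) (flow≤bound (W ==ˢ W′) refl)
  where
    open HardCore G 0<lam
    open Flow G X pd X-last 0<lam γ canonical W W′
    flow≤bound : ∀ b → (W ==ˢ W′) ≡ b → flow ≤ π G lam W * P G lam W W′ * bound G X lam
    flow≤bound true  W≡W′ = ≤-trans (≤-reflexive (flow-loop W≡W′)) (*-nonNeg (*-nonNeg (π-nonNeg W) (<⇒≤ 0<P)) bound-nonNeg)
    flow≤bound false W≢W′ =
      let v , flipped , 0<mp , mp≤P = positive-transition W≢W′ 0<P
      in  ≤-trans (Flipping.flow≤ v flipped W-indep)
                  (C*M²≤ (≤-trans (moveProb-lower W v 0<mp) (*-monoˡ-≤ (*-nonNeg (ℕtoℚ-nonNeg (n ℕ.+ n)) (0≤Λ 0<lam)) mp≤P)))
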